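{- Let $N$ be a $3$-connected cubic planar simple graph with a fixed plane embedding, and let $Q$ be constructed from $N$ as in the context. Then $Q$ is $3$-connected, planar and simple.
   Context: First construct $P$: for each edge $uv$ of $N$ introduce four new vertices $a(uv),a(vu),d(uv),d(vu)$ (order of arguments matters) and replace the edge $uv$ by the subgraph $P_{uv}$ consisting of the $4$-cycle $a(uv)\,d(uv)\,a(vu)\,d(vu)$ and the edges $u\,a(uv)$, $v\,a(vu)$, $d(uv)\,d(vu)$. Take a plane embedding of $P$ obtained from that of $N$ by drawing each $P_{uv}$ near the former edge $uv$, with the names $d(uv),d(vu)$ chosen so that each $4$-cycle $(a(uv)\,d(uv)\,a(vu)\,d(vu))$ is clockwise in this cyclic order. For adjacent $u,v$ in $N$, $\mathrm{cwn}_N(v,u)$ denotes the neighbor of $v$ immediately clockwise from $u$ in the rotation around $v$ in the plane embedding of $N$. Construct $Q$ from $P$ by replacing each edge $a(uv)\,d(uv)$ with a path $a(uv)\,b(uv)\,c(uv)\,d(uv)$ through two new vertices $b(uv),c(uv)$, and then, for each vertex $c(uv)$, adding the bracing edge $c(uv)\,b(vw)$ where $w=\mathrm{cwn}_N(v,u)$. -}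

module Defs where

open import Data.Nat using (ℕ; zero; suc; _+_; _*_; _<_; _≤ᵇ_)
open import Data.Fin using (Fin; toℕ; _↑ˡ_; _↑ʳ_; combine; remQuot)
open import Data.Bool using (Bool; true; false; not; if_then_else_; _∧_)
open import Data.Product using (Σ; ∃; ∃-syntax; _×_; _,_; proj₁; proj₂)
open import Data.Sum using (_⊎_)
open import Data.List using (List; length; filter; allFin; upTo; foldr)
open import Data.Vec using (Vec; _∷_; []; lookup)
open import Data.Empty using (⊥)
open import Relation.Nullary using (¬_)
open import Relation.Nullary.Decidable using (does)
open import Relation.Binary.PropositionalEquality using (_≡_; _≢_)
open import Data.Fin.Properties using () renaming (_≟_ to _≟F_)
open import Function using (_∘_)

-- Finite multigraphs: vertices Fin n, edges Fin m, each edge has an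
-- ordered pair of ends (loops and parallel edges are representable).

record MGraph : Set where
  field
    n    : ℕ
    m    : ℕ
    ends : Fin m → Fin n × Fin n

module _ (G : MGraph) where
  open MGraph G

  -- darts (half-edges / oriented edges): (i , true) goes from the first
  -- end of edge i to the second, (i , false) the other way.
  Dart : Set
  Dart = Fin m × Bool

  tail : Dart → Fin n
  tail (i , true)  = proj₁ (ends i)
  tail (i , false) = proj₂ (ends i)

  head : Dart → Fin n
  head (i , b) = tail (i , not b)

  rev : Dart → Dart
  rev (i , b) = (i , not b)

  allDarts : List Dart
  allDarts = Data.List.cartesianProduct (allFin m) (true Data.List.∷ false Data.List.∷ Data.List.[])

  degree : Fin n → ℕ
  degree v = length (filter (λ d → tail d ≟F v) allDarts)

  Cubic : Set
  Cubic = ∀ v → degree v ≡ 3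

  Simple : Set
  Simple = (∀ i → proj₁ (ends i) ≢ proj₂ (ends i))
         × (∀ i j → (ends i ≡ ends j ⊎ (proj₁ (ends i) ≡ proj₂ (ends j) × proj₂ (ends i) ≡ proj₁ (ends j))) → i ≡ j)

  -- walks in G − X, where X is a predicate of deleted vertices
  data Reach (X : Fin n → Set) : Fin n → Fin n → Set where
    here : ∀ {u} → ¬ X u → Reach X u u
    step : ∀ {u w} (d : Dart) → tail d ≡ u → ¬ X u → Reach X (head d) w → Reach X u w

  Connected : Set
  Connected = ∀ u v → Reach (λ _ → ⊥) u v

  -- 3-connected: more than 3 vertices, and G − S is connected for every
  -- vertex set S with |S| ≤ 2 (|S| = 0 is the clause Connected, sets of
  -- size 1 or 2 are {x , y}).
  ThreeConnected : Set
  ThreeConnected = 3 < n × Connected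
    × (∀ (x y u v : Fin n) → u ≢ x → u ≢ y → v ≢ x → v ≢ y
         → Reach (λ w → w ≡ x ⊎ w ≡ y) u v)

  iter : (Dart → Dart) → ℕ → Dart → Dart
  iter f zero    d = d
  iter f (suc k) d = f (iter f k d)

  -- rotation system: a permutation σ of the darts preserving tails and
  -- cyclic on the darts at each vertex (σ d = next dart clockwise
  -- around tail d).
  record Rotation : Set where
    field
      σ      : Dart → Dart
      σ⁻¹    : Dart → Dart
      σσ⁻¹   : ∀ d → σ (σ⁻¹ d) ≡ d
      σ⁻¹σ   : ∀ d → σ⁻¹ (σ d) ≡ d
      σtail  : ∀ d → tail (σ d) ≡ tail d
      cyclic : ∀ d d′ → tail d ≡ tail d′ → ∃[ k ] iter σ k d ≡ d′

  face : Rotation → Dart → Dart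
  face R d = Rotation.σ R (rev d)

  code : Dart → ℕ
  code (i , b) = toℕ i * 2 + (if b then 1 else 0)

  -- d represents its face-orbit iff it has the least code in its orbit
  -- (orbits have size ≤ number of darts = 2m, so k < 2m covers them).
  isFaceRep : Rotation → Dart → Bool
  isFaceRep R d = foldr (λ k r → r ∧ ( code d ≤ᵇ code (iter (face R) k d))) true (upTo (2 * m))

  faces : Rotation → ℕ
  faces R = length (filter (λ d → isFaceRep R d Data.Bool.≟ true) allDarts)

  -- a plane (genus 0) embedding of a connected graph: Euler's formula
  PlaneEmbedding : Set
  PlaneEmbedding = Σ Rotation λ R → n + faces R ≡ m + 2

  Planar : Set
  Planar = PlaneEmbedding

-- Vertices of Q: the n vertices of N, then for every dart δ of N
-- (an oriented edge uv) the four vertices a(uv), b(uv), c(uv), d(uv).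

module _ (N : MGraph) (R : Rotation N) where
  open MGraph N

  QV : Set
  QV = Fin (n + m * (2 * 4))

  dirF : Bool → Fin 2
  dirF true  = Fin.zero
  dirF false = Fin.suc Fin.zero

  newV : Dart N → Fin 4 → QV
  newV (i , b) k = n ↑ʳ combine i (combine (dirF b) k)

  O : Fin n → QV
  O v = v ↑ˡ (m * (2 * 4))

  A B C D : Dart N → QV
  A δ = newV δ Fin.zero
  B δ = newV δ (Fin.suc Fin.zero)
  C δ = newV δ (Fin.suc (Fin.suc Fin.zero))
  D δ = newV δ (Fin.suc (Fin.suc (Fin.suc Fin.zero)))

  -- cwn as a map on darts: for the dart u→v, the dart v→w with
  -- w = cwn_N(v,u)
  next : Dart N → Dart N
  next δ = Rotation.σ R (rev N δ)

  -- the 13 edges of Q coming from edge i = uv of N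
  -- (δ₁ = uv, δ₂ = vu)
  qEdges : Fin m → Vec (QV × QV) 13
  qEdges i =
      (O (tail N δ₁) , A δ₁)
    ∷ (O (tail N δ₂) , A δ₂)
    ∷ (A δ₁ , B δ₁) ∷ (B δ₁ , C δ₁) ∷ (C δ₁ , D δ₁)
    ∷ (D δ₁ , A δ₂)
    ∷ (A δ₂ , B δ₂) ∷ (B δ₂ , C δ₂) ∷ (C δ₂ , D δ₂)
    ∷ (D δ₂ , A δ₁)
    ∷ (D δ₁ , D δ₂)
    ∷ (C δ₁ , B (next δ₁))
    ∷ (C δ₂ , B (next δ₂))
    ∷ []
    where
      δ₁ δ₂ : Dart N
      δ₁ = (i , true)
      δ₂ = (i , false)

  Q : MGraph
  Q = record
    { n    = n + m * (2 * 4)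
    ; m    = m * 13
    ; ends = λ e → let (i , j) = remQuot 13 e in lookup (qEdges i) j
    }

module Submission where

-- Q is obtained from the cubic plane graph N by replacing every edge uv with a
-- gadget of eight new vertices a,b,c,d(uv), a,b,c,d(vu) and bracing each
-- c(uv) to b(vw), w = cwn(v,u).
--
--  * Simple.  Every edge of Q is recovered from its unordered pair of ends
--    (decodeEdge), so there are no loops and no parallel edges.
--  * Planar.  We write down an explicit rotation system for Q (the clockwise
--    order of the gadgets around N) and count its faces.  Every face of Q is
--    a "corner" face at a dart of N, a "pentagon" inside the gadget of a dart,
--    or the lift of a face of N, so faces(Q) = 2m + 2m + faces(N); Euler's
--    formula for N then gives Euler's formula for Q.  Counting orbits uses a
--    general fact: a complete orbit invariant with a section counts the faces.
--  * 3-connected.  Delete two vertices x, y of Q; they "damage" at most two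
--    vertices of N.  Every surviving vertex of Q reaches an undamaged vertex of
--    N (new vertices via three internally disjoint paths, damaged vertices of
--    N via one of their three darts), and undamaged vertices of N are joined
--    in N minus the damage, which lifts to Q minus {x, y}.

open import Defs
open import Data.Nat using (ℕ; zero; suc; _+_; _*_; _∸_; _<_; _≤_; _≤ᵇ_; s≤s; s≤s⁻¹; z≤n)
open import Data.Nat.Properties
  using (≤-trans; <-≤-trans; ≤-antisym; <⇒≤; n<1+n; m≤m+n; +-comm; +-identityʳ; +-monoʳ-≤; *-comm; *-monoˡ-≤;
         *-cancelʳ-≡; +-cancelʳ-≡; suc-injective; m∸n≤m; m<n⇒0<n∸m; m+[n∸m]≡n; m∸n+n≡m; m≤n⇒m<n∨m≡n;
         ≤ᵇ⇒≤; ≤⇒≤ᵇ; ≰⇒>)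
open import Data.Nat.Induction using (<-wellFounded)
open import Induction.WellFounded using (Acc; acc)
open import Data.Fin using (Fin; toℕ; fromℕ<; _↑ʳ_; combine; remQuot; splitAt; join)
import Data.Fin as F
open import Data.Fin.Properties
  using (pigeonhole; toℕ-fromℕ<; toℕ<n; toℕ-injective; splitAt-↑ˡ; splitAt-↑ʳ; remQuot-combine; combine-remQuot;
         join-splitAt; all?)
  renaming (_≟_ to _≟F_)
open import Data.Bool using (Bool; true; false; not; _∧_; T; if_then_else_)
open import Data.Bool.Properties using () renaming (_≟_ to _≟B_)
open import Data.Product using (Σ; ∃-syntax; _×_; _,_; proj₁; proj₂; swap)
open import Data.Product.Properties using (≡-dec)
open import Data.Sum using (_⊎_; inj₁; inj₂)
open import Data.Empty using (⊥; ⊥-elim)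
open import Data.Unit using (⊤; tt)
open import Data.Maybe using (Maybe; just; nothing)
open import Data.Maybe.Properties using (just-injective)
open import Data.Vec using (Vec; []; _∷_; lookup)
open import Data.List using (List; []; _∷_; _++_; map; foldr; upTo; filter; length; allFin; cartesianProduct)
open import Data.List.Properties using (length-removeAt′; length-++; length-map; length-tabulate; filter-++; filter-all)
open import Data.List.Membership.Propositional using (_∈_)
open import Data.List.Membership.Propositional.Properties
  using (∈-upTo⁺; ∈-filter⁺; ∈-filter⁻; ∈-allFin; ∈-cartesianProduct⁺)
open import Data.List.Relation.Unary.Any using (here; there; index; _─_)
open import Data.List.Relation.Unary.All using (All; []; _∷_)
import Data.List.Relation.Unary.All as All
open import Data.List.Relation.Unary.AllPairs using ([]; _∷_)
import Data.List.Relation.Unary.AllPairs as AllPairs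
open import Data.List.Relation.Unary.Unique.Propositional using (Unique)
import Data.List.Relation.Unary.Unique.Propositional.Properties as Unique
open import Relation.Nullary using (¬_; Dec; yes; no; does)
open import Relation.Nullary.Decidable using (toWitness)
open import Relation.Unary using (Decidable)
open import Relation.Binary.PropositionalEquality
open import Data.Nat.Tactic.RingSolver using (solve-∀)

iterate : {X : Set} → (X → X) → ℕ → X → X
iterate f zero    x = x
iterate f (suc k) x = f (iterate f k x)

iterate-+ : ∀ {X : Set} (f : X → X) a b x → iterate f (a + b) x ≡ iterate f a (iterate f b x)
iterate-+ f zero    b x = refl
iterate-+ f (suc a) b x = cong f (iterate-+ f a b x)

iterate-natural : ∀ {X Y : Set} {f : X → X} {g : Y → Y} (h : X → Y)
                → (∀ x → h (f x) ≡ g (h x)) → ∀ k x → h (iterate f k x) ≡ iterate g k (h x)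
iterate-natural h comm zero    x = refl
iterate-natural {g = g} h comm (suc k) x = trans (comm _) (cong g (iterate-natural h comm k x))

iter≡iterate : ∀ G (f : Dart G → Dart G) k d → iter G f k d ≡ iterate f k d
iter≡iterate G f zero    d = refl
iter≡iterate G f (suc k) d = cong f (iter≡iterate G f k d)

-- Conjunction over a list of indices, in the shape used by isFaceRep.

allOf : (ℕ → Bool) → List ℕ → Bool
allOf g ks = foldr (λ k r → r ∧ g k) true ks

allOf-true : ∀ g ks → allOf g ks ≡ true → ∀ k → k ∈ ks → g k ≡ true
allOf-true g (k ∷ ks) h .k (here refl) with allOf g ks | g k
... | true | true = refl
allOf-true g (k′ ∷ ks) h k (there k∈) with allOf g ks in eq | g k′
... | true | true = allOf-true g ks eq k k∈

allOf-false : ∀ g ks → allOf g ks ≡ false → ∃[ k ] (k ∈ ks × g k ≡ false)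
allOf-false g (k ∷ ks) h with allOf g ks in eq | g k in eq′
... | true  | false = k , here refl , eq′
... | false | _     = let (k′ , k′∈ , e) = allOf-false g ks eq in k′ , there k′∈ , e

allOf-cong : ∀ g g′ ks → (∀ k → g k ≡ g′ k) → allOf g ks ≡ allOf g′ ks
allOf-cong g g′ []       h = refl
allOf-cong g g′ (k ∷ ks) h = cong₂ _∧_ (allOf-cong g g′ ks h) (h k)

-- Being in the same orbit is an
-- equivalence relation, and every orbit has a unique element of least code;
-- leastB decides leastness by testing the first B iterates, exactly as
-- isFaceRep does.

module Orbits {X : Set} (f g : X → X) (gf : ∀ x → g (f x) ≡ x)
              (code : X → ℕ) (B : ℕ) (code< : ∀ x → code x < B)
              (code-inj : ∀ x y → code x ≡ code y → x ≡ y) where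

  _~_ : X → X → Set
  x ~ y = ∃[ k ] iterate f k x ≡ y

  iterate-inj : ∀ k {x y} → iterate f k x ≡ iterate f k y → x ≡ y
  iterate-inj zero    e = e
  iterate-inj (suc k) {x} {y} e =
    iterate-inj k (trans (sym (gf _)) (trans (cong g e) (gf _)))

  -- By pigeonhole among the first B+1 iterates, every point is periodic with
  -- period at most B.
  period : ∀ x → ∃[ p ] (0 < p × p ≤ B × iterate f p x ≡ x)
  period x with pigeonhole (n<1+n B) (λ k → fromℕ< (code< (iterate f (toℕ k) x)))
  ... | (i , j , i<j , e) =
    toℕ j ∸ toℕ i , m<n⇒0<n∸m i<j , ≤-trans (m∸n≤m (toℕ j) (toℕ i)) (s≤s⁻¹ (toℕ<n j)) ,
    sym (iterate-inj (toℕ i) (trans same (trans (cong (λ z → iterate f z x) (sym (m+[n∸m]≡n (<⇒≤ i<j))))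
                                              (iterate-+ f (toℕ i) (toℕ j ∸ toℕ i) x))))
    where
      same : iterate f (toℕ i) x ≡ iterate f (toℕ j) x
      same = code-inj _ _ (trans (sym (toℕ-fromℕ< (code< _))) (trans (cong toℕ e) (toℕ-fromℕ< (code< _))))

  ~-refl : ∀ {x} → x ~ x
  ~-refl = 0 , refl

  ~-trans : ∀ {x y z} → x ~ y → y ~ z → x ~ z
  ~-trans {x} (k , refl) (l , refl) = l + k , iterate-+ f l k x

  ~-step : ∀ x → x ~ f x
  ~-step x = 1 , refl

  -- Periodicity lets us run an orbit backwards.
  ~-sym : ∀ {x y} → x ~ y → y ~ x
  ~-sym {x} (k , refl) = back k
    where
      back : ∀ k → iterate f k x ~ x
      back zero = 0 , refl
      back (suc k) with back k
      ... | (suc j , e) = j , trans (sym (iterate-+ f j 1 (iterate f k x)))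
                                    (trans (cong (λ z → iterate f z (iterate f k x)) (+-comm j 1)) e)
      ... | (zero , e) with period x
      ... | (suc p , _ , _ , e′) = p , trans (cong (λ z → iterate f p (f z)) e)
               (trans (sym (iterate-+ f p 1 x)) (trans (cong (λ z → iterate f z x) (+-comm p 1)) e′))

  bounded : ∀ k x → ∃[ j ] (j < B × iterate f k x ≡ iterate f j x)
  bounded k x with period x
  ... | (p , p>0 , p≤B , fp≡) = let (j , j<p , e) = go k in j , <-≤-trans j<p p≤B , e
    where
      go : ∀ k → ∃[ j ] (j < p × iterate f k x ≡ iterate f j x)
      go zero = 0 , p>0 , refl
      go (suc k) with go k
      ... | (j , j<p , e) with m≤n⇒m<n∨m≡n j<p
      ... | inj₁ sj<p = suc j , sj<p , cong f e
      ... | inj₂ sj≡p = 0 , p>0 , trans (cong f e) (trans (cong (λ z → iterate f z x) sj≡p) fp≡)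

  Least : X → Set
  Least x = ∀ y → x ~ y → code x ≤ code y

  leastB : X → Bool
  leastB x = allOf (λ k → code x ≤ᵇ code (iterate f k x)) (upTo B)

  leastB-sound : ∀ x → leastB x ≡ true → Least x
  leastB-sound x h y (k , refl) with bounded k x
  ... | (j , j<B , e) = subst (λ z → code x ≤ code z) (sym e)
          (≤ᵇ⇒≤ (code x) _ (subst T (sym (allOf-true _ (upTo B) h j (∈-upTo⁺ j<B))) tt))

  leastB-complete : ∀ x → Least x → leastB x ≡ true
  leastB-complete x least with leastB x in eq
  ... | true  = refl
  ... | false with allOf-false _ (upTo B) eq
  ... | (k , _ , e) = ⊥-elim (subst T e (≤⇒≤ᵇ (least _ (k , refl))))

  -- Descend to strictly smaller codes until the test succeeds.
  least-in-orbit : ∀ x → Σ X λ r → x ~ r × Least r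
  least-in-orbit x = go x (<-wellFounded (code x))
    where
      go : ∀ x → Acc _<_ (code x) → Σ X λ r → x ~ r × Least r
      go x (acc smaller) with leastB x in eq
      ... | true  = x , ~-refl , leastB-sound x eq
      ... | false with allOf-false _ (upTo B) eq
      ... | (k , _ , e) with go (iterate f k x) (smaller (≰⇒> (λ le → subst T e (≤⇒≤ᵇ le))))
      ... | (r , xr , least) = r , ~-trans (k , refl) xr , least

  least-unique : ∀ {r r′} → Least r → Least r′ → r ~ r′ → r ≡ r′
  least-unique {r} {r′} h h′ e = code-inj r r′ (≤-antisym (h r′ e) (h′ r (~-sym e)))

  rep : X → X
  rep x = proj₁ (least-in-orbit x)

  rep-~ : ∀ x → x ~ rep x
  rep-~ x = proj₁ (proj₂ (least-in-orbit x))

  rep-least : ∀ x → Least (rep x)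
  rep-least x = proj₂ (proj₂ (least-in-orbit x))

  rep-resp : ∀ {x y} → x ~ y → rep x ≡ rep y
  rep-resp {x} {y} e = least-unique (rep-least x) (rep-least y) (~-trans (~-sym (rep-~ x)) (~-trans e (rep-~ y)))

  rep-fixed : ∀ x → Least x → rep x ≡ x
  rep-fixed x h = least-unique (rep-least x) h (~-sym (rep-~ x))

∈-─ : ∀ {B : Set} {x y : B} (ws : List B) (p : x ∈ ws) → y ∈ ws → y ≢ x → y ∈ (ws ─ p)
∈-─ (w ∷ ws) (here refl) (here refl) ne = ⊥-elim (ne refl)
∈-─ (w ∷ ws) (here refl) (there q)   ne = q
∈-─ (w ∷ ws) (there p)   (here refl) ne = here refl
∈-─ (w ∷ ws) (there p)   (there q)   ne = there (∈-─ ws p q ne)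

injection-length : ∀ {A B : Set} (zs : List A) (ws : List B) → Unique zs → (h : A → B)
                 → (∀ {a b} → a ∈ zs → b ∈ zs → h a ≡ h b → a ≡ b)
                 → (∀ {a} → a ∈ zs → h a ∈ ws) → length zs ≤ length ws
injection-length []       ws u h inj into = z≤n
injection-length (a ∷ zs) ws (a∉ ∷ u) h inj into =
  subst (λ z → suc (length zs) ≤ z) (sym (length-removeAt′ ws (index ha∈)))
    (s≤s (injection-length zs (ws ─ ha∈) u h (λ p q → inj (there p) (there q))
      (λ p → ∈-─ ws ha∈ (into (there p)) (λ e → All.lookup a∉ p (inj (here refl) (there p) (sym e))))))
  where
    ha∈ : h a ∈ ws
    ha∈ = into (here refl)

module _ {X Y : Set} {P : X → Set} {P′ : Y → Set} (P? : Decidable P) (P′? : Decidable P′)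
         {xs : List X} {ys : List Y} (xs! : Unique xs) (ys! : Unique ys)
         (∈xs : ∀ x → x ∈ xs) (∈ys : ∀ y → y ∈ ys)
         (φ : X → Y) (ψ : Y → X) (φP : ∀ x → P x → P′ (φ x)) (ψP : ∀ y → P′ y → P (ψ y))
         (φψ : ∀ y → P′ y → φ (ψ y) ≡ y) (ψφ : ∀ x → P x → ψ (φ x) ≡ x) where

  count-by-bijection : length (filter P? xs) ≡ length (filter P′? ys)
  count-by-bijection = ≤-antisym
    (injection-length _ _ (Unique.filter⁺ P? xs!) φ
       (λ p q e → trans (sym (ψφ _ (proj₂ (∈-filter⁻ P? {xs = xs} p))))
                        (trans (cong ψ e) (ψφ _ (proj₂ (∈-filter⁻ P? {xs = xs} q)))))
       (λ p → ∈-filter⁺ P′? (∈ys _) (φP _ (proj₂ (∈-filter⁻ P? {xs = xs} p)))))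
    (injection-length _ _ (Unique.filter⁺ P′? ys!) ψ
       (λ p q e → trans (sym (φψ _ (proj₂ (∈-filter⁻ P′? {xs = ys} p))))
                        (trans (cong φ e) (φψ _ (proj₂ (∈-filter⁻ P′? {xs = ys} q)))))
       (λ p → ∈-filter⁺ P? (∈xs _) (ψP _ (proj₂ (∈-filter⁻ P′? {xs = ys} p)))))

filter-map : ∀ {A B : Set} {P : B → Set} (P? : Decidable P) (f : A → B) (xs : List A)
           → filter P? (map f xs) ≡ map f (filter (λ x → P? (f x)) xs)
filter-map P? f []       = refl
filter-map P? f (x ∷ xs) with does (P? (f x))
... | true  = cong (f x ∷_) (filter-map P? f xs)
... | false = filter-map P? f xs

Connected-minus-two : MGraph → Set
Connected-minus-two G = ∀ (x y u v : Fin (MGraph.n G)) → u ≢ x → u ≢ y → v ≢ x → v ≢ y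
                      → Reach G (λ w → w ≡ x ⊎ w ≡ y) u v

module Darts (G : MGraph) where
  open MGraph G

  rev-rev : ∀ d → rev G (rev G d) ≡ d
  rev-rev (i , true)  = refl
  rev-rev (i , false) = refl

  rev-inj : ∀ {d d′} → rev G d ≡ rev G d′ → d ≡ d′
  rev-inj {d} {d′} e = trans (sym (rev-rev d)) (trans (cong (rev G) e) (rev-rev d′))

  rev≢ : ∀ d → rev G d ≢ d
  rev≢ (i , true)  ()
  rev≢ (i , false) ()

  _≟D_ : (d d′ : Dart G) → Dec (d ≡ d′)
  _≟D_ = ≡-dec _≟F_ _≟B_

  allDarts-unique : Unique (allDarts G)
  allDarts-unique = Unique.cartesianProduct⁺ (Unique.allFin⁺ m) (((λ ()) ∷ []) ∷ [] ∷ [])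

  ∈-allDarts : ∀ d → d ∈ allDarts G
  ∈-allDarts (i , true)  = ∈-cartesianProduct⁺ (∈-allFin i) (here refl)
  ∈-allDarts (i , false) = ∈-cartesianProduct⁺ (∈-allFin i) (there (here refl))

  private
    odd≢even : ∀ x y → x * 2 + 1 ≢ y * 2
    odd≢even zero    zero    ()
    odd≢even zero    (suc y) ()
    odd≢even (suc x) zero    ()
    odd≢even (suc x) (suc y) e = odd≢even x y (suc-injective (suc-injective e))

    bit≤1 : ∀ b → (if b then 1 else 0) ≤ 1
    bit≤1 true  = s≤s z≤n
    bit≤1 false = z≤n

  code< : ∀ d → code G d < 2 * m
  code< (i , b) = ≤-trans (s≤s (+-monoʳ-≤ (toℕ i * 2) (bit≤1 b)))
    (subst₂ _≤_ (cong suc (+-comm 1 (toℕ i * 2))) (*-comm m 2) (*-monoˡ-≤ 2 (toℕ<n i)))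

  code-inj : ∀ d d′ → code G d ≡ code G d′ → d ≡ d′
  code-inj (i , true)  (j , true)  e = cong (_, true) (toℕ-injective (*-cancelʳ-≡ _ _ 2 (+-cancelʳ-≡ _ _ _ e)))
  code-inj (i , false) (j , false) e = cong (_, false) (toℕ-injective (*-cancelʳ-≡ _ _ 2 (+-cancelʳ-≡ _ _ _ e)))
  code-inj (i , true)  (j , false) e = ⊥-elim (odd≢even (toℕ i) (toℕ j) (trans e (+-identityʳ _)))
  code-inj (i , false) (j , true)  e = ⊥-elim (odd≢even (toℕ j) (toℕ i) (sym (trans (sym (+-identityʳ _)) e)))

module FaceOrbits (G : MGraph) (Rot : Rotation G) where
  open MGraph G
  open Rotation Rot
  open Darts G

  -- face d = σ (rev d) has the left inverse rev ∘ σ⁻¹.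
  open Orbits (face G Rot) (λ d → rev G (σ⁻¹ d)) (λ d → trans (cong (rev G) (σ⁻¹σ (rev G d))) (rev-rev d))
              (code G) (2 * m) code< code-inj public

  isFaceRep≡leastB : ∀ d → isFaceRep G Rot d ≡ leastB d
  isFaceRep≡leastB d =
    allOf-cong _ _ (upTo (2 * m)) (λ k → cong (λ z → code G d ≤ᵇ code G z) (iter≡iterate G (face G Rot) k d))

  faces-by-invariant : {Y : Set} {P : Y → Set} (P? : Decidable P) {ys : List Y} → Unique ys → (∀ y → y ∈ ys)
    → (ι : Dart G → Y) (canon : Y → Dart G)
    → (∀ d → P (ι d))
    → (∀ d → ι (face G Rot d) ≡ ι d)
    → (∀ y → P y → ι (canon y) ≡ y)
    → (∀ d → canon (ι d) ~ d)
    → faces G Rot ≡ length (filter P? ys)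
  faces-by-invariant P? ys! ∈ys ι canon ιP ι-face ι-canon canon-~ =
    count-by-bijection (λ d → isFaceRep G Rot d ≟B true) P? allDarts-unique ys! ∈-allDarts ∈ys
      ι (λ y → rep (canon y))
      (λ d _ → ιP d)
      (λ y _ → trans (isFaceRep≡leastB (rep (canon y))) (leastB-complete (rep (canon y)) (rep-least (canon y))))
      (λ y Py → trans (ι-~ (rep-~ (canon y))) (ι-canon y Py))
      (λ d isRep → trans (rep-resp (canon-~ d))
                         (rep-fixed d (leastB-sound d (trans (sym (isFaceRep≡leastB d)) isRep))))
    where
      ι-~ : ∀ {d d′} → d ~ d′ → ι d′ ≡ ι d
      ι-~ (zero  , refl) = refl
      ι-~ (suc k , refl) = trans (ι-face _) (ι-~ (k , refl))

module Walks (G : MGraph) where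
  open MGraph G
  open Darts G using (rev-rev)

  start-ok : ∀ {X u w} → Reach G X u w → ¬ X u
  start-ok (here nx)       = nx
  start-ok (step d e nx r) = nx

  end-ok : ∀ {X u w} → Reach G X u w → ¬ X w
  end-ok (here nx)       = nx
  end-ok (step d e nx r) = end-ok r

  _++R_ : ∀ {X u v w} → Reach G X u v → Reach G X v w → Reach G X u w
  here nx       ++R r′ = r′
  step d e nx r ++R r′ = step d e nx (r ++R r′)

  reverseR : ∀ {X u w} → Reach G X u w → Reach G X w u
  reverseR (here nx) = here nx
  reverseR {X} (step d refl nx r) = reverseR r ++R step (rev G d) refl (start-ok r)
    (subst (λ z → Reach G X (tail G z) (tail G d)) (sym (rev-rev d)) (here nx))

  monoR : ∀ {X X′ : Fin n → Set} {u w} → (∀ z → X′ z → X z) → Reach G X u w → Reach G X′ u w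
  monoR h (here nx)       = here (λ z → nx (h _ z))
  monoR h (step d e nx r) = step d e (λ z → nx (h _ z)) (monoR h r)

-- A vertex of Q is an old vertex of N or the k-th of the
-- four new vertices a, b, c, d of a dart of N; an edge of Q is one of six
-- edges attached to a dart (o–a, a–b, b–c, c–d, d–a(rev), c–b(next)) or the
-- rung d(uv)–d(vu) of an edge of N.

pattern kA = F.zero
pattern kB = F.suc F.zero
pattern kC = F.suc (F.suc F.zero)
pattern kD = F.suc (F.suc (F.suc F.zero))

data EdgeKind : Set where
  oa ab bc cd da cb : EdgeKind

-- The position of an edge among the 13 edges of Q listed by qEdges.
data Slot : Set where
  side   : Bool → EdgeKind → Slot
  middle : Slot

slotIndex : Slot → Fin 13
slotIndex (side true  oa) = F.# 0
slotIndex (side false oa) = F.# 1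
slotIndex (side true  ab) = F.# 2
slotIndex (side true  bc) = F.# 3
slotIndex (side true  cd) = F.# 4
slotIndex (side true  da) = F.# 5
slotIndex (side false ab) = F.# 6
slotIndex (side false bc) = F.# 7
slotIndex (side false cd) = F.# 8
slotIndex (side false da) = F.# 9
slotIndex middle          = F.# 10
slotIndex (side true  cb) = F.# 11
slotIndex (side false cb) = F.# 12

slots : Vec Slot 13
slots = side true oa ∷ side false oa ∷ side true ab ∷ side true bc ∷ side true cd ∷ side true da
      ∷ side false ab ∷ side false bc ∷ side false cd ∷ side false da ∷ middle ∷ side true cb ∷ side false cb ∷ []

slotIndex-slots : ∀ j → slotIndex (lookup slots j) ≡ j
slotIndex-slots = toWitness {a? = all? (λ j → slotIndex (lookup slots j) ≟F j)} tt

slots-slotIndex : ∀ s → lookup slots (slotIndex s) ≡ s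
slots-slotIndex (side true  oa) = refl
slots-slotIndex (side false oa) = refl
slots-slotIndex (side true  ab) = refl
slots-slotIndex (side false ab) = refl
slots-slotIndex (side true  bc) = refl
slots-slotIndex (side false bc) = refl
slots-slotIndex (side true  cd) = refl
slots-slotIndex (side false cd) = refl
slots-slotIndex (side true  da) = refl
slots-slotIndex (side false da) = refl
slots-slotIndex (side true  cb) = refl
slots-slotIndex (side false cb) = refl
slots-slotIndex middle          = refl

module Coordinates (N : MGraph) (R : Rotation N) where
  open MGraph N

  data QVertex : Set where
    old : Fin n → QVertex
    new : Dart N → Fin 4 → QVertex

  data QEdge : Set where
    gadget : Dart N → EdgeKind → QEdge
    rung   : Fin m → QEdge

  private
    bool : Fin 2 → Bool
    bool F.zero    = true
    bool (F.suc _) = false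

    bool-dirF : ∀ b → bool (dirF N R b) ≡ b
    bool-dirF true  = refl
    bool-dirF false = refl

    dirF-bool : ∀ j → dirF N R (bool j) ≡ j
    dirF-bool F.zero          = refl
    dirF-bool (F.suc F.zero) = refl

    newOf : Fin m × Fin (2 * 4) → QVertex
    newOf (i , j) = let (s , k) = remQuot {2} 4 j in new (i , bool s) k

    viewSum : Fin n ⊎ Fin (m * (2 * 4)) → QVertex
    viewSum (inj₁ v) = old v
    viewSum (inj₂ r) = newOf (remQuot {m} (2 * 4) r)

  view : QV N R → QVertex
  view x = viewSum (splitAt n x)

  unview : QVertex → QV N R
  unview (old v)   = O N R v
  unview (new δ k) = newV N R δ k

  view-old : ∀ v → view (O N R v) ≡ old v
  view-old v = cong viewSum (splitAt-↑ˡ n v (m * (2 * 4)))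

  view-new : ∀ δ k → view (newV N R δ k) ≡ new δ k
  view-new (i , b) k = begin
    viewSum (splitAt n (n ↑ʳ combine i (combine (dirF N R b) k)))
      ≡⟨ cong viewSum (splitAt-↑ʳ n (m * (2 * 4)) _) ⟩
    newOf (remQuot {m} (2 * 4) (combine i (combine (dirF N R b) k)))
      ≡⟨ cong newOf (remQuot-combine i _) ⟩
    new (i , bool (proj₁ (remQuot {2} 4 (combine (dirF N R b) k)))) (proj₂ (remQuot {2} 4 (combine (dirF N R b) k)))
      ≡⟨ cong (λ p → new (i , bool (proj₁ p)) (proj₂ p)) (remQuot-combine (dirF N R b) k) ⟩
    new (i , bool (dirF N R b)) k
      ≡⟨ cong (λ z → new (i , z) k) (bool-dirF b) ⟩
    new (i , b) k ∎
    where open ≡-Reasoning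

  view-unview : ∀ w → view (unview w) ≡ w
  view-unview (old v)   = view-old v
  view-unview (new δ k) = view-new δ k

  unview-view : ∀ x → unview (view x) ≡ x
  unview-view x with splitAt n x in eq
  ... | inj₁ v = trans (cong (join n (m * (2 * 4))) (sym eq)) (join-splitAt n (m * (2 * 4)) x)
  ... | inj₂ r = trans newOf-ok (trans (cong (join n (m * (2 * 4))) (sym eq)) (join-splitAt n (m * (2 * 4)) x))
    where
      newOf-ok : unview (newOf (remQuot {m} (2 * 4) r)) ≡ n ↑ʳ r
      i : Fin m
      i = proj₁ (remQuot {m} (2 * 4) r)
      j : Fin (2 * 4)
      j = proj₂ (remQuot {m} (2 * 4) r)
      newOf-ok = cong (n ↑ʳ_) (begin
        combine i (combine (dirF N R (bool (proj₁ (remQuot {2} 4 j)))) (proj₂ (remQuot {2} 4 j)))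
          ≡⟨ cong (λ z → combine i (combine z (proj₂ (remQuot {2} 4 j)))) (dirF-bool (proj₁ (remQuot {2} 4 j))) ⟩
        combine i (combine (proj₁ (remQuot {2} 4 j)) (proj₂ (remQuot {2} 4 j)))
          ≡⟨ cong (combine i) (combine-remQuot {2} 4 j) ⟩
        combine i j
          ≡⟨ combine-remQuot {m} (2 * 4) r ⟩
        r ∎)
        where open ≡-Reasoning

  view-inj : ∀ {x y} → view x ≡ view y → x ≡ y
  view-inj {x} {y} e = trans (sym (unview-view x)) (trans (cong unview e) (unview-view y))

  unview-inj : ∀ {v w} → unview v ≡ unview w → v ≡ w
  unview-inj {v} {w} e = trans (sym (view-unview v)) (trans (cong view e) (view-unview w))

  endsV : QEdge → QVertex × QVertex
  endsV (gadget δ oa) = old (tail N δ) , new δ kA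
  endsV (gadget δ ab) = new δ kA , new δ kB
  endsV (gadget δ bc) = new δ kB , new δ kC
  endsV (gadget δ cd) = new δ kC , new δ kD
  endsV (gadget δ da) = new δ kD , new (rev N δ) kA
  endsV (gadget δ cb) = new δ kC , new (next N R δ) kB
  endsV (rung i)      = new (i , true) kD , new (i , false) kD

  atSlot : Fin m → Slot → QEdge
  atSlot i (side b k) = gadget (i , b) k
  atSlot i middle     = rung i

  toE : QEdge → Fin (m * 13)
  toE (gadget (i , b) k) = combine i (slotIndex (side b k))
  toE (rung i)           = combine i (slotIndex middle)

  fromE : Fin (m * 13) → QEdge
  fromE e = let (i , j) = remQuot {m} 13 e in atSlot i (lookup slots j)

  fromE-toE : ∀ q → fromE (toE q) ≡ q
  fromE-toE (gadget (i , b) k) =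
    trans (cong (λ p → atSlot (proj₁ p) (lookup slots (proj₂ p))) (remQuot-combine i _))
          (cong (atSlot i) (slots-slotIndex (side b k)))
  fromE-toE (rung i) = cong (λ p → atSlot (proj₁ p) (lookup slots (proj₂ p))) (remQuot-combine i _)

  toE-fromE : ∀ e → toE (fromE e) ≡ e
  toE-fromE e = trans (toE-atSlot i (lookup slots j))
                      (trans (cong (combine i) (slotIndex-slots j)) (combine-remQuot {m} 13 e))
    where
      i : Fin m
      i = proj₁ (remQuot {m} 13 e)
      j : Fin 13
      j = proj₂ (remQuot {m} 13 e)
      toE-atSlot : ∀ i s → toE (atSlot i s) ≡ combine i (slotIndex s)
      toE-atSlot i (side b k) = refl
      toE-atSlot i middle     = refl

  fromE-inj : ∀ {e e′} → fromE e ≡ fromE e′ → e ≡ e′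
  fromE-inj {e} {e′} h = trans (sym (toE-fromE e)) (trans (cong toE h) (toE-fromE e′))

  unview₂ : QVertex × QVertex → QV N R × QV N R
  unview₂ (v , w) = unview v , unview w

  unview₂-inj : ∀ {p p′} → unview₂ p ≡ unview₂ p′ → p ≡ p′
  unview₂-inj {_ , _} {_ , _} e = cong₂ _,_ (unview-inj (cong proj₁ e)) (unview-inj (cong proj₂ e))

  private
    qEdges-slot : ∀ i s → lookup (qEdges N R i) (slotIndex s) ≡ unview₂ (endsV (atSlot i s))
    qEdges-slot i (side true  oa) = refl
    qEdges-slot i (side false oa) = refl
    qEdges-slot i (side true  ab) = refl
    qEdges-slot i (side false ab) = refl
    qEdges-slot i (side true  bc) = refl
    qEdges-slot i (side false bc) = refl
    qEdges-slot i (side true  cd) = refl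
    qEdges-slot i (side false cd) = refl
    qEdges-slot i (side true  da) = refl
    qEdges-slot i (side false da) = refl
    qEdges-slot i (side true  cb) = refl
    qEdges-slot i (side false cb) = refl
    qEdges-slot i middle          = refl

  ends-toE : ∀ q → MGraph.ends (Q N R) (toE q) ≡ unview₂ (endsV q)
  ends-toE (gadget (i , b) k) =
    trans (cong (λ p → lookup (qEdges N R (proj₁ p)) (proj₂ p)) (remQuot-combine i _)) (qEdges-slot i (side b k))
  ends-toE (rung i) =
    trans (cong (λ p → lookup (qEdges N R (proj₁ p)) (proj₂ p)) (remQuot-combine i _)) (qEdges-slot i middle)

  endOf : ∀ q {p} (π : QV N R × QV N R → QV N R) → endsV q ≡ p → π (MGraph.ends (Q N R) (toE q)) ≡ π (unview₂ p)
  endOf q π e = trans (cong π (ends-toE q)) (cong (λ z → π (unview₂ z)) e)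

  ends-view : ∀ e → MGraph.ends (Q N R) e ≡ unview₂ (endsV (fromE e))
  ends-view e = trans (cong (MGraph.ends (Q N R)) (sym (toE-fromE e))) (ends-toE (fromE e))

module SimpleGraph (G : MGraph) (simple : Simple G) where
  open MGraph G

  loopless : ∀ d → tail G d ≢ head G d
  loopless (i , true)  e = proj₁ simple i e
  loopless (i , false) e = proj₁ simple i (sym e)

  parallel : ∀ d d′ → tail G d ≡ tail G d′ → head G d ≡ head G d′ → d ≡ d′
  parallel (i , true) (j , true) e₁ e₂ with proj₂ simple i j (inj₁ (cong₂ _,_ e₁ e₂))
  ... | refl = refl
  parallel (i , false) (j , false) e₁ e₂ with proj₂ simple i j (inj₁ (cong₂ _,_ e₂ e₁))
  ... | refl = refl
  parallel (i , true) (j , false) e₁ e₂ with proj₂ simple i j (inj₂ (e₁ , e₂))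
  ... | refl = ⊥-elim (loopless (i , true) e₁)
  parallel (i , false) (j , true) e₁ e₂ with proj₂ simple i j (inj₂ (e₂ , e₁))
  ... | refl = ⊥-elim (loopless (i , true) e₂)

  -- next δ leaves head δ, so it is not δ (N has no loops).
  next≢ : (Rot : Rotation G) → ∀ δ → next G Rot δ ≢ δ
  next≢ Rot δ e = loopless δ (trans (sym (cong (tail G) e)) (Rotation.σtail Rot (rev G δ)))

-- Q is simple: an edge of Q is determined by its unordered pair of ends.

module Simplicity (N : MGraph) (R : Rotation N) (simple : Simple N) where
  open Coordinates N R
  open Darts N using (_≟D_)
  open SimpleGraph N simple using (next≢)

  bcEdge : Dart N → Dart N → QEdge
  bcEdge β γ with β ≟D γ
  ... | yes _ = gadget β bc
  ... | no _  = gadget γ cb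

  decodeEdge : QVertex × QVertex → Maybe QEdge
  decodeEdge (old _ , new δ kA)          = just (gadget δ oa)
  decodeEdge (new δ kA , old _)          = just (gadget δ oa)
  decodeEdge (new δ kA , new _ kB)       = just (gadget δ ab)
  decodeEdge (new _ kB , new δ kA)       = just (gadget δ ab)
  decodeEdge (new β kB , new γ kC)       = just (bcEdge β γ)
  decodeEdge (new γ kC , new β kB)       = just (bcEdge β γ)
  decodeEdge (new δ kC , new _ kD)       = just (gadget δ cd)
  decodeEdge (new _ kD , new δ kC)       = just (gadget δ cd)
  decodeEdge (new δ kD , new _ kA)       = just (gadget δ da)
  decodeEdge (new _ kA , new δ kD)       = just (gadget δ da)
  decodeEdge (new (i , _) kD , new _ kD) = just (rung i)
  decodeEdge _                           = nothing

  bcEdge-bc : ∀ δ → bcEdge δ δ ≡ gadget δ bc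
  bcEdge-bc δ with δ ≟D δ
  ... | yes _ = refl
  ... | no ne = ⊥-elim (ne refl)

  bcEdge-cb : ∀ δ → bcEdge (next N R δ) δ ≡ gadget δ cb
  bcEdge-cb δ with next N R δ ≟D δ
  ... | yes e = ⊥-elim (next≢ R δ e)
  ... | no _  = refl

  decode-ends : ∀ q → decodeEdge (endsV q) ≡ just q
  decode-ends (gadget δ oa) = refl
  decode-ends (gadget δ ab) = refl
  decode-ends (gadget δ bc) = cong just (bcEdge-bc δ)
  decode-ends (gadget δ cd) = refl
  decode-ends (gadget δ da) = refl
  decode-ends (gadget δ cb) = cong just (bcEdge-cb δ)
  decode-ends (rung i)      = refl

  decode-ends-swap : ∀ q → decodeEdge (swap (endsV q)) ≡ just q
  decode-ends-swap (gadget δ oa) = refl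
  decode-ends-swap (gadget δ ab) = refl
  decode-ends-swap (gadget δ bc) = cong just (bcEdge-bc δ)
  decode-ends-swap (gadget δ cd) = refl
  decode-ends-swap (gadget δ da) = refl
  decode-ends-swap (gadget δ cb) = cong just (bcEdge-cb δ)
  decode-ends-swap (rung i)      = refl

  endsV-distinct : ∀ q → proj₁ (endsV q) ≢ proj₂ (endsV q)
  endsV-distinct (gadget δ oa) ()
  endsV-distinct (gadget δ ab) ()
  endsV-distinct (gadget δ bc) ()
  endsV-distinct (gadget δ cd) ()
  endsV-distinct (gadget δ da) ()
  endsV-distinct (gadget δ cb) ()
  endsV-distinct (rung i)      ()

  simpleQ : Simple (Q N R)
  simpleQ = no-loop , no-parallel
    where
      no-loop : ∀ e → proj₁ (MGraph.ends (Q N R) e) ≢ proj₂ (MGraph.ends (Q N R) e)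
      no-loop e h = endsV-distinct (fromE e)
        (unview-inj (trans (sym (cong proj₁ (ends-view e))) (trans h (cong proj₂ (ends-view e)))))

      decodes-to : ∀ {e e′} → endsV (fromE e) ≡ endsV (fromE e′) ⊎ endsV (fromE e) ≡ swap (endsV (fromE e′))
                 → e ≡ e′
      decodes-to {e} {e′} (inj₁ h) =
        fromE-inj (just-injective (trans (sym (decode-ends _)) (trans (cong decodeEdge h) (decode-ends _))))
      decodes-to {e} {e′} (inj₂ h) =
        fromE-inj (just-injective (trans (sym (decode-ends _)) (trans (cong decodeEdge h) (decode-ends-swap _))))

      no-parallel : ∀ e e′ → (MGraph.ends (Q N R) e ≡ MGraph.ends (Q N R) e′
                              ⊎ (proj₁ (MGraph.ends (Q N R) e) ≡ proj₂ (MGraph.ends (Q N R) e′)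
                                 × proj₂ (MGraph.ends (Q N R) e) ≡ proj₁ (MGraph.ends (Q N R) e′)))
                  → e ≡ e′
      no-parallel e e′ (inj₁ h) =
        decodes-to (inj₁ (unview₂-inj (trans (sym (ends-view e)) (trans h (ends-view e′)))))
      no-parallel e e′ (inj₂ (h₁ , h₂)) = decodes-to (inj₂ (unview₂-inj
        (cong₂ _,_ (trans (sym (cong proj₁ (ends-view e))) (trans h₁ (cong proj₂ (ends-view e′))))
                   (trans (sym (cong proj₂ (ends-view e))) (trans h₂ (cong proj₁ (ends-view e′)))))))

-- The rotation system of Q.  Around an old vertex u the gadgets follow the
-- rotation of N; each new vertex has three darts, listed clockwise.

module RotationQ (N : MGraph) (R : Rotation N) where
  open MGraph N
  open Rotation R
  open Coordinates N R
  open Darts N using (rev-rev)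

  QDart : Set
  QDart = QEdge × Bool

  toQ : QDart → Dart (Q N R)
  toQ (q , b) = toE q , b

  fromQ : Dart (Q N R) → QDart
  fromQ (e , b) = fromE e , b

  fromQ-toQ : ∀ x → fromQ (toQ x) ≡ x
  fromQ-toQ (q , b) = cong (_, b) (fromE-toE q)

  toQ-fromQ : ∀ d → toQ (fromQ d) ≡ d
  toQ-fromQ (e , b) = cong (_, b) (toE-fromE e)

  tailV : QDart → QVertex
  tailV (q , true)  = proj₁ (endsV q)
  tailV (q , false) = proj₂ (endsV q)

  tail-toQ : ∀ x → tail (Q N R) (toQ x) ≡ unview (tailV x)
  tail-toQ (q , true)  = cong proj₁ (ends-toE q)
  tail-toQ (q , false) = cong proj₂ (ends-toE q)

  tail-fromQ : ∀ d → view (tail (Q N R) d) ≡ tailV (fromQ d)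
  tail-fromQ d = trans (cong (λ z → view (tail (Q N R) z)) (sym (toQ-fromQ d)))
                       (trans (cong view (tail-toQ (fromQ d))) (view-unview _))

  prev : Dart N → Dart N
  prev δ = rev N (σ⁻¹ δ)

  next-prev : ∀ δ → next N R (prev δ) ≡ δ
  next-prev δ = trans (cong σ (rev-rev (σ⁻¹ δ))) (σσ⁻¹ δ)

  prev-next : ∀ δ → prev (next N R δ) ≡ δ
  prev-next δ = trans (cong (rev N) (σ⁻¹σ (rev N δ))) (rev-rev δ)

  rotQ : QDart → QDart
  rotQ (gadget δ oa , true)  = gadget (σ δ) oa , true
  rotQ (gadget δ oa , false) = gadget δ ab , true
  rotQ (gadget δ ab , true)  = gadget (rev N δ) da , false
  rotQ (gadget δ da , false) = gadget (rev N δ) oa , false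
  rotQ (gadget δ ab , false) = gadget (prev δ) cb , false
  rotQ (gadget δ cb , false) = gadget (next N R δ) bc , true
  rotQ (gadget δ bc , true)  = gadget δ ab , false
  rotQ (gadget δ bc , false) = gadget δ cb , true
  rotQ (gadget δ cb , true)  = gadget δ cd , true
  rotQ (gadget δ cd , true)  = gadget δ bc , false
  rotQ (gadget δ cd , false) = gadget δ da , true
  rotQ (gadget (i , b) da , true) = rung i , b
  rotQ (rung i , b)          = gadget (i , b) cd , false

  rotQ⁻¹ : QDart → QDart
  rotQ⁻¹ (gadget δ oa , true)  = gadget (σ⁻¹ δ) oa , true
  rotQ⁻¹ (gadget δ ab , true)  = gadget δ oa , false
  rotQ⁻¹ (gadget δ da , false) = gadget (rev N δ) ab , true
  rotQ⁻¹ (gadget δ oa , false) = gadget (rev N δ) da , false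
  rotQ⁻¹ (gadget δ cb , false) = gadget (next N R δ) ab , false
  rotQ⁻¹ (gadget δ bc , true)  = gadget (prev δ) cb , false
  rotQ⁻¹ (gadget δ ab , false) = gadget δ bc , true
  rotQ⁻¹ (gadget δ cb , true)  = gadget δ bc , false
  rotQ⁻¹ (gadget δ cd , true)  = gadget δ cb , true
  rotQ⁻¹ (gadget δ bc , false) = gadget δ cd , true
  rotQ⁻¹ (gadget δ da , true)  = gadget δ cd , false
  rotQ⁻¹ (rung i , b)          = gadget (i , b) da , true
  rotQ⁻¹ (gadget (i , b) cd , false) = rung i , b

  rotQ-rotQ⁻¹ : ∀ x → rotQ (rotQ⁻¹ x) ≡ x
  rotQ-rotQ⁻¹ (gadget δ oa , true)  = cong (λ z → gadget z oa , true) (σσ⁻¹ δ)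
  rotQ-rotQ⁻¹ (gadget δ ab , true)  = refl
  rotQ-rotQ⁻¹ (gadget δ da , false) = cong (λ z → gadget z da , false) (rev-rev δ)
  rotQ-rotQ⁻¹ (gadget δ oa , false) = cong (λ z → gadget z oa , false) (rev-rev δ)
  rotQ-rotQ⁻¹ (gadget δ cb , false) = cong (λ z → gadget z cb , false) (prev-next δ)
  rotQ-rotQ⁻¹ (gadget δ bc , true)  = cong (λ z → gadget z bc , true) (next-prev δ)
  rotQ-rotQ⁻¹ (gadget δ ab , false) = refl
  rotQ-rotQ⁻¹ (gadget δ cb , true)  = refl
  rotQ-rotQ⁻¹ (gadget δ cd , true)  = refl
  rotQ-rotQ⁻¹ (gadget δ bc , false) = refl
  rotQ-rotQ⁻¹ (gadget δ da , true)  = refl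
  rotQ-rotQ⁻¹ (rung i , b)          = refl
  rotQ-rotQ⁻¹ (gadget (i , b) cd , false) = refl

  rotQ⁻¹-rotQ : ∀ x → rotQ⁻¹ (rotQ x) ≡ x
  rotQ⁻¹-rotQ (gadget δ oa , true)  = cong (λ z → gadget z oa , true) (σ⁻¹σ δ)
  rotQ⁻¹-rotQ (gadget δ oa , false) = refl
  rotQ⁻¹-rotQ (gadget δ ab , true)  = cong (λ z → gadget z ab , true) (rev-rev δ)
  rotQ⁻¹-rotQ (gadget δ da , false) = cong (λ z → gadget z da , false) (rev-rev δ)
  rotQ⁻¹-rotQ (gadget δ ab , false) = cong (λ z → gadget z ab , false) (next-prev δ)
  rotQ⁻¹-rotQ (gadget δ cb , false) = cong (λ z → gadget z cb , false) (prev-next δ)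
  rotQ⁻¹-rotQ (gadget δ bc , true)  = refl
  rotQ⁻¹-rotQ (gadget δ bc , false) = refl
  rotQ⁻¹-rotQ (gadget δ cb , true)  = refl
  rotQ⁻¹-rotQ (gadget δ cd , true)  = refl
  rotQ⁻¹-rotQ (gadget δ cd , false) = refl
  rotQ⁻¹-rotQ (gadget (i , b) da , true) = refl
  rotQ⁻¹-rotQ (rung i , b)          = refl

  rotQ-tail : ∀ x → tailV (rotQ x) ≡ tailV x
  rotQ-tail (gadget δ oa , true)  = cong old (σtail δ)
  rotQ-tail (gadget δ oa , false) = refl
  rotQ-tail (gadget δ ab , true)  = cong (λ z → new z kA) (rev-rev δ)
  rotQ-tail (gadget δ da , false) = refl
  rotQ-tail (gadget δ ab , false) = cong (λ z → new z kB) (next-prev δ)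
  rotQ-tail (gadget δ cb , false) = refl
  rotQ-tail (gadget δ bc , true)  = refl
  rotQ-tail (gadget δ bc , false) = refl
  rotQ-tail (gadget δ cb , true)  = refl
  rotQ-tail (gadget δ cd , true)  = refl
  rotQ-tail (gadget δ cd , false) = refl
  rotQ-tail (gadget (i , true)  da , true) = refl
  rotQ-tail (gadget (i , false) da , true) = refl
  rotQ-tail (rung i , true)       = refl
  rotQ-tail (rung i , false)      = refl

  iterate-tail : ∀ j x → tailV (iterate rotQ j x) ≡ tailV x
  iterate-tail zero    x = refl
  iterate-tail (suc j) x = trans (rotQ-tail (iterate rotQ j x)) (iterate-tail j x)

  firstDart : Dart N → Fin 4 → QDart
  firstDart δ kA = gadget δ oa , false
  firstDart δ kB = gadget δ ab , false
  firstDart δ kC = gadget δ bc , false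
  firstDart δ kD = gadget δ cd , false

  firstDart-tail : ∀ δ k → tailV (firstDart δ k) ≡ new δ k
  firstDart-tail δ kA = refl
  firstDart-tail δ kB = refl
  firstDart-tail δ kC = refl
  firstDart-tail δ kD = refl

  new-tail : ∀ δ k j → tailV (iterate rotQ j (firstDart δ k)) ≡ new δ k
  new-tail δ k j = trans (iterate-tail j (firstDart δ k)) (firstDart-tail δ k)

  period3 : ∀ δ k → iterate rotQ 3 (firstDart δ k) ≡ firstDart δ k
  period3 δ kA = cong (λ z → gadget z oa , false) (rev-rev δ)
  period3 δ kB = cong (λ z → gadget z ab , false) (next-prev δ)
  period3 δ kC = refl
  period3 (i , true)  kD = refl
  period3 (i , false) kD = refl

  data DartClass (x : QDart) : Set where
    at-old : ∀ δ → x ≡ (gadget δ oa , true) → DartClass x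
    at-new : ∀ δ k (j : Fin 3) → iterate rotQ (toℕ j) (firstDart δ k) ≡ x → DartClass x

  classify : ∀ x → DartClass x
  classify (gadget δ oa , true)  = at-old δ refl
  classify (gadget δ oa , false) = at-new δ kA (F.# 0) refl
  classify (gadget δ ab , true)  = at-new δ kA (F.# 1) refl
  classify (gadget ε da , false) = at-new (rev N ε) kA (F.# 2) (cong (λ z → gadget z da , false) (rev-rev ε))
  classify (gadget δ ab , false) = at-new δ kB (F.# 0) refl
  classify (gadget ε cb , false) = at-new (next N R ε) kB (F.# 1) (cong (λ z → gadget z cb , false) (prev-next ε))
  classify (gadget δ bc , true)  = at-new δ kB (F.# 2) (cong (λ z → gadget z bc , true) (next-prev δ))
  classify (gadget δ bc , false) = at-new δ kC (F.# 0) refl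
  classify (gadget δ cb , true)  = at-new δ kC (F.# 1) refl
  classify (gadget δ cd , true)  = at-new δ kC (F.# 2) refl
  classify (gadget δ cd , false) = at-new δ kD (F.# 0) refl
  classify (gadget δ da , true)  = at-new δ kD (F.# 1) refl
  classify (rung i , true)       = at-new (i , true) kD (F.# 2) refl
  classify (rung i , false)      = at-new (i , false) kD (F.# 2) refl

  iterate-at-old : ∀ k δ → iterate rotQ k (gadget δ oa , true) ≡ (gadget (iterate σ k δ) oa , true)
  iterate-at-old zero    δ = refl
  iterate-at-old (suc k) δ = cong rotQ (iterate-at-old k δ)

  rotQ-cyclic : ∀ x x′ → tailV x ≡ tailV x′ → ∃[ k ] iterate rotQ k x ≡ x′
  rotQ-cyclic x x′ h with classify x | classify x′
  ... | at-old δ refl | at-old δ′ refl with cyclic δ δ′ (old-inj h)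
    where
      old-inj : ∀ {u v} → old u ≡ old v → u ≡ v
      old-inj refl = refl
  ... | (k , e) =
    k , trans (iterate-at-old k δ) (cong (λ z → gadget z oa , true) (trans (sym (iter≡iterate N σ k δ)) e))
  rotQ-cyclic x x′ h | at-old δ refl | at-new δ′ k′ j′ refl
    with () ← trans h (new-tail δ′ k′ (toℕ j′))
  rotQ-cyclic x x′ h | at-new δ k j refl | at-old δ′ refl
    with () ← trans (sym (new-tail δ k (toℕ j))) h
  rotQ-cyclic x x′ h | at-new δ k j refl | at-new δ′ k′ j′ refl
    with trans (sym (new-tail δ k (toℕ j))) (trans h (new-tail δ′ k′ (toℕ j′)))
  ... | refl = toℕ j′ + (3 ∸ toℕ j) , (begin
        iterate rotQ (toℕ j′ + (3 ∸ toℕ j)) (iterate rotQ (toℕ j) x₀)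
          ≡⟨ iterate-+ rotQ (toℕ j′) (3 ∸ toℕ j) _ ⟩
        iterate rotQ (toℕ j′) (iterate rotQ (3 ∸ toℕ j) (iterate rotQ (toℕ j) x₀))
          ≡⟨ cong (iterate rotQ (toℕ j′)) (sym (iterate-+ rotQ (3 ∸ toℕ j) (toℕ j) x₀)) ⟩
        iterate rotQ (toℕ j′) (iterate rotQ ((3 ∸ toℕ j) + toℕ j) x₀)
          ≡⟨ cong (λ z → iterate rotQ (toℕ j′) (iterate rotQ z x₀)) (m∸n+n≡m (<⇒≤ (toℕ<n j))) ⟩
        iterate rotQ (toℕ j′) (iterate rotQ 3 x₀)
          ≡⟨ cong (iterate rotQ (toℕ j′)) (period3 δ k) ⟩
        iterate rotQ (toℕ j′) x₀ ∎)
    where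
      open ≡-Reasoning
      x₀ : QDart
      x₀ = firstDart δ k

  σQ : Dart (Q N R) → Dart (Q N R)
  σQ d = toQ (rotQ (fromQ d))

  toQ-rotQ : ∀ x → toQ (rotQ x) ≡ σQ (toQ x)
  toQ-rotQ x = cong (λ z → toQ (rotQ z)) (sym (fromQ-toQ x))

  rotationQ : Rotation (Q N R)
  rotationQ = record
    { σ      = σQ
    ; σ⁻¹    = λ d → toQ (rotQ⁻¹ (fromQ d))
    ; σσ⁻¹   = λ d → trans (cong (λ z → toQ (rotQ z)) (fromQ-toQ (rotQ⁻¹ (fromQ d))))
                           (trans (cong toQ (rotQ-rotQ⁻¹ (fromQ d))) (toQ-fromQ d))
    ; σ⁻¹σ   = λ d → trans (cong (λ z → toQ (rotQ⁻¹ z)) (fromQ-toQ (rotQ (fromQ d))))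
                           (trans (cong toQ (rotQ⁻¹-rotQ (fromQ d))) (toQ-fromQ d))
    ; σtail  = λ d → view-inj (trans (tail-fromQ (σQ d))
                      (trans (cong tailV (fromQ-toQ (rotQ (fromQ d)))) (trans (rotQ-tail (fromQ d)) (sym (tail-fromQ d)))))
    ; cyclic = λ d d′ h →
        let (k , e) = rotQ-cyclic (fromQ d) (fromQ d′) (trans (sym (tail-fromQ d)) (trans (cong view h) (tail-fromQ d′)))
        in k , (begin
          iter (Q N R) σQ k d               ≡⟨ iter≡iterate (Q N R) σQ k d ⟩
          iterate σQ k d                    ≡⟨ cong (iterate σQ k) (sym (toQ-fromQ d)) ⟩
          iterate σQ k (toQ (fromQ d))      ≡⟨ sym (iterate-natural toQ toQ-rotQ k (fromQ d)) ⟩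
          toQ (iterate rotQ k (fromQ d))    ≡⟨ cong toQ e ⟩
          toQ (fromQ d′)                    ≡⟨ toQ-fromQ d′ ⟩
          d′                                ∎)
    }
    where open ≡-Reasoning

-- Each face of Q is of one of three kinds: the corner face at
-- the tail of a dart δ (between δ and σ δ), the pentagon a b c d d′ inside
-- the gadget of δ, or the lift of a face of N, which runs along the edges
-- b(δ) c(δ) b(next δ) ... of the darts δ of that face.

data FaceKind : Set where
  corner pentagon lifted : FaceKind

module FacesQ (N : MGraph) (R : Rotation N) where
  open MGraph N
  open Rotation R
  open Coordinates N R
  open RotationQ N R
  open Darts N using (rev-rev; allDarts-unique; ∈-allDarts)
  module FN = FaceOrbits N R
  module FQ = FaceOrbits (Q N R) rotationQ

  faceQD : QDart → QDart
  faceQD (q , b) = rotQ (q , not b)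

  toQ-face : ∀ x → toQ (faceQD x) ≡ face (Q N R) rotationQ (toQ x)
  toQ-face (q , b) = cong (λ z → toQ (rotQ (z , not b))) (sym (fromE-toE q))

  FaceIndex : Set
  FaceIndex = FaceKind × Dart N

  -- The face containing a dart (a lifted face is named by the least dart of
  -- the corresponding face of N).
  faceOf : QDart → FaceIndex
  faceOf (gadget δ oa , false) = corner , δ
  faceOf (gadget ε oa , true)  = corner , σ⁻¹ ε
  faceOf (gadget ε ab , true)  = corner , σ⁻¹ ε
  faceOf (gadget ε cb , false) = corner , rev N ε
  faceOf (gadget ε cd , true)  = corner , rev N ε
  faceOf (gadget ε da , true)  = corner , rev N ε
  faceOf (gadget δ bc , false) = pentagon , δ
  faceOf (gadget δ ab , false) = pentagon , δ
  faceOf (gadget ε da , false) = pentagon , rev N ε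
  faceOf (rung i , b)          = pentagon , (i , not b)
  faceOf (gadget δ cd , false) = pentagon , δ
  faceOf (gadget δ bc , true)  = lifted , FN.rep δ
  faceOf (gadget δ cb , true)  = lifted , FN.rep δ

  faceOf-face : ∀ x → faceOf (faceQD x) ≡ faceOf x
  faceOf-face (gadget δ oa , false) = cong (corner ,_) (σ⁻¹σ δ)
  faceOf-face (gadget ε oa , true)  = refl
  faceOf-face (gadget ε ab , true)  = cong (corner ,_) (rev-rev (σ⁻¹ ε))
  faceOf-face (gadget ε cb , false) = refl
  faceOf-face (gadget ε cd , true)  = refl
  faceOf-face (gadget ε da , true)  = refl
  faceOf-face (gadget δ bc , false) = refl
  faceOf-face (gadget δ ab , false) = cong (pentagon ,_) (rev-rev δ)
  faceOf-face (gadget (i , b) da , false) = refl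
  faceOf-face (rung i , b)          = refl
  faceOf-face (gadget δ cd , false) = refl
  faceOf-face (gadget δ bc , true)  = refl
  faceOf-face (gadget δ cb , true)  = cong (lifted ,_) (FN.rep-resp (FN.~-sym (FN.~-step δ)))

  canonical : FaceIndex → QDart
  canonical (corner , δ)   = gadget δ oa , false
  canonical (pentagon , δ) = gadget δ bc , false
  canonical (lifted , δ)   = gadget δ bc , true

  -- Only the least dart of each face of N names a lifted face.
  Genuine : FaceIndex → Set
  Genuine (corner , δ)   = ⊤
  Genuine (pentagon , δ) = ⊤
  Genuine (lifted , δ)   = isFaceRep N R δ ≡ true

  genuine? : ∀ y → Dec (Genuine y)
  genuine? (corner , δ)   = yes tt
  genuine? (pentagon , δ) = yes tt
  genuine? (lifted , δ)   = isFaceRep N R δ ≟B true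

  rep-isFaceRep : ∀ δ → isFaceRep N R (FN.rep δ) ≡ true
  rep-isFaceRep δ = trans (FN.isFaceRep≡leastB (FN.rep δ)) (FN.leastB-complete (FN.rep δ) (FN.rep-least δ))

  faceOf-genuine : ∀ x → Genuine (faceOf x)
  faceOf-genuine (gadget δ oa , false) = tt
  faceOf-genuine (gadget ε oa , true)  = tt
  faceOf-genuine (gadget ε ab , true)  = tt
  faceOf-genuine (gadget ε cb , false) = tt
  faceOf-genuine (gadget ε cd , true)  = tt
  faceOf-genuine (gadget ε da , true)  = tt
  faceOf-genuine (gadget δ bc , false) = tt
  faceOf-genuine (gadget δ ab , false) = tt
  faceOf-genuine (gadget ε da , false) = tt
  faceOf-genuine (rung i , b)          = tt
  faceOf-genuine (gadget δ cd , false) = tt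
  faceOf-genuine (gadget δ bc , true)  = rep-isFaceRep δ
  faceOf-genuine (gadget δ cb , true)  = rep-isFaceRep δ

  faceOf-canonical : ∀ y → Genuine y → faceOf (canonical y) ≡ y
  faceOf-canonical (corner , δ)   _ = refl
  faceOf-canonical (pentagon , δ) _ = refl
  faceOf-canonical (lifted , δ)   p =
    cong (lifted ,_) (FN.rep-fixed δ (FN.leastB-sound δ (trans (sym (FN.isFaceRep≡leastB δ)) p)))

  reaches : ∀ k x y → iterate faceQD k x ≡ y → toQ x FQ.~ toQ y
  reaches k x y e = k , trans (sym (iterate-natural toQ toQ-face k x)) (cong toQ e)

  -- Two face steps of Q along b–c edges follow one face step of N.
  lift-face : ∀ k δ → toQ (gadget δ bc , true) FQ.~ toQ (gadget (iterate (face N R) k δ) bc , true)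
  lift-face zero    δ = FQ.~-refl
  lift-face (suc k) δ = FQ.~-trans (lift-face k δ) (reaches 2 (gadget (iterate (face N R) k δ) bc , true) _ refl)

  lift-to-rep : ∀ δ → toQ (gadget (FN.rep δ) bc , true) FQ.~ toQ (gadget δ bc , true)
  lift-to-rep δ with FN.~-sym (FN.rep-~ δ)
  ... | (k , e) =
    subst (λ z → toQ (gadget (FN.rep δ) bc , true) FQ.~ toQ (gadget z bc , true)) e (lift-face k (FN.rep δ))

  from-canonical : ∀ x k → iterate faceQD k (canonical (faceOf x)) ≡ x → toQ (canonical (faceOf x)) FQ.~ toQ x
  from-canonical x k = reaches k (canonical (faceOf x)) x

  canonical-reaches : ∀ x → toQ (canonical (faceOf x)) FQ.~ toQ x
  canonical-reaches (gadget δ oa , false) =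
    from-canonical (gadget δ oa , false) 0 refl
  canonical-reaches (gadget ε oa , true) =
    from-canonical (gadget ε oa , true) 1 (cong (λ z → gadget z oa , true) (σσ⁻¹ ε))
  canonical-reaches (gadget ε ab , true) =
    from-canonical (gadget ε ab , true) 2 (cong (λ z → gadget z ab , true) (σσ⁻¹ ε))
  canonical-reaches (gadget ε cb , false) =
    from-canonical (gadget ε cb , false) 3 (cong (λ z → gadget z cb , false) (prev-next ε))
  canonical-reaches (gadget ε cd , true) =
    from-canonical (gadget ε cd , true) 4 (cong (λ z → gadget z cd , true) (prev-next ε))
  canonical-reaches (gadget ε da , true) =
    from-canonical (gadget ε da , true) 5 (cong (λ z → gadget z da , true) (prev-next ε))
  canonical-reaches (gadget δ bc , false) =
    from-canonical (gadget δ bc , false) 0 refl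
  canonical-reaches (gadget δ ab , false) =
    from-canonical (gadget δ ab , false) 1 refl
  canonical-reaches (gadget ε da , false) =
    from-canonical (gadget ε da , false) 2 (cong (λ z → gadget z da , false) (rev-rev ε))
  canonical-reaches (rung i , true) =
    from-canonical (rung i , true) 3 refl
  canonical-reaches (rung i , false) =
    from-canonical (rung i , false) 3 refl
  canonical-reaches (gadget (i , true)  cd , false) =
    from-canonical (gadget (i , true)  cd , false) 4 refl
  canonical-reaches (gadget (i , false) cd , false) =
    from-canonical (gadget (i , false) cd , false) 4 refl
  canonical-reaches (gadget δ bc , true)  = lift-to-rep δ
  canonical-reaches (gadget δ cb , true)  = FQ.~-trans (lift-to-rep δ) (reaches 1 (gadget δ bc , true) _ refl)

  kinds : List FaceKind
  kinds = corner ∷ pentagon ∷ lifted ∷ []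

  faceIndices : List FaceIndex
  faceIndices = cartesianProduct kinds (allDarts N)

  faceIndices-unique : Unique faceIndices
  faceIndices-unique =
    Unique.cartesianProduct⁺ {xs = kinds}
      (((λ ()) ∷ (λ ()) ∷ []) ∷ ((λ ()) ∷ []) ∷ [] ∷ []) allDarts-unique

  ∈-faceIndices : ∀ y → y ∈ faceIndices
  ∈-faceIndices (corner   , δ) = ∈-cartesianProduct⁺ {xs = kinds} (here refl) (∈-allDarts δ)
  ∈-faceIndices (pentagon , δ) = ∈-cartesianProduct⁺ {xs = kinds} (there (here refl)) (∈-allDarts δ)
  ∈-faceIndices (lifted   , δ) = ∈-cartesianProduct⁺ {xs = kinds} (there (there (here refl))) (∈-allDarts δ)

  faces≡genuine : faces (Q N R) rotationQ ≡ length (filter genuine? faceIndices)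
  faces≡genuine = FQ.faces-by-invariant genuine? faceIndices-unique ∈-faceIndices
    (λ d → faceOf (fromQ d)) (λ y → toQ (canonical y))
    (λ d → faceOf-genuine (fromQ d))
    (λ d → begin
      faceOf (fromQ (face (Q N R) rotationQ d))
        ≡⟨ cong (λ z → faceOf (fromQ (face (Q N R) rotationQ z))) (sym (toQ-fromQ d)) ⟩
      faceOf (fromQ (face (Q N R) rotationQ (toQ (fromQ d))))
        ≡⟨ cong (λ z → faceOf (fromQ z)) (sym (toQ-face (fromQ d))) ⟩
      faceOf (fromQ (toQ (faceQD (fromQ d))))
        ≡⟨ cong faceOf (fromQ-toQ (faceQD (fromQ d))) ⟩
      faceOf (faceQD (fromQ d))
        ≡⟨ faceOf-face (fromQ d) ⟩
      faceOf (fromQ d) ∎)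
    (λ y Gy → trans (cong faceOf (fromQ-toQ (canonical y))) (faceOf-canonical y Gy))
    (λ d → subst (λ z → toQ (canonical (faceOf (fromQ d))) FQ.~ z) (toQ-fromQ d) (canonical-reaches (fromQ d)))
    where open ≡-Reasoning

  -- 2m corner faces, 2m pentagons and the faces of N.
  facesQ : faces (Q N R) rotationQ ≡ m * 2 + (m * 2 + (faces N R + 0))
  facesQ = trans faces≡genuine (begin
      length (filter genuine? (map (corner ,_) L ++ (map (pentagon ,_) L ++ (map (lifted ,_) L ++ []))))
        ≡⟨ length-filter-++ (map (corner ,_) L) _ ⟩
      count corner + length (filter genuine? (map (pentagon ,_) L ++ (map (lifted ,_) L ++ [])))
        ≡⟨ cong (count corner +_) (length-filter-++ (map (pentagon ,_) L) _) ⟩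
      count corner + (count pentagon + length (filter genuine? (map (lifted ,_) L ++ [])))
        ≡⟨ cong (λ z → count corner + (count pentagon + z)) (length-filter-++ (map (lifted ,_) L) []) ⟩
      count corner + (count pentagon + (count lifted + 0))
        ≡⟨ cong₂ (λ z w → z + (w + (count lifted + 0)))
                 (count-all corner (λ _ → tt)) (count-all pentagon (λ _ → tt)) ⟩
      length L + (length L + (count lifted + 0))
        ≡⟨ cong₂ (λ z w → z + (z + (w + 0))) length-allDarts (count-kind lifted) ⟩
      m * 2 + (m * 2 + (faces N R + 0)) ∎)
    where
      open ≡-Reasoning
      L : List (Dart N)
      L = allDarts N

      count : FaceKind → ℕ
      count k = length (filter genuine? (map (k ,_) L))

      length-filter-++ : ∀ xs ys
                       → length (filter genuine? (xs ++ ys)) ≡ length (filter genuine? xs) + length (filter genuine? ys)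
      length-filter-++ xs ys = trans (cong length (filter-++ genuine? xs ys)) (length-++ (filter genuine? xs))

      count-kind : ∀ k → count k ≡ length (filter (λ δ → genuine? (k , δ)) L)
      count-kind k = trans (cong length (filter-map genuine? (k ,_) L))
                           (length-map (k ,_) (filter (λ δ → genuine? (k , δ)) L))

      count-all : ∀ k → (∀ δ → Genuine (k , δ)) → count k ≡ length L
      count-all k all-genuine =
        trans (count-kind k) (cong length (filter-all (λ δ → genuine? (k , δ)) (All.universal all-genuine L)))

      length-pairs : ∀ (is : List (Fin m)) → length (cartesianProduct is (true ∷ false ∷ [])) ≡ length is * 2
      length-pairs []       = refl
      length-pairs (i ∷ is) = cong (λ z → suc (suc z)) (length-pairs is)

      length-allDarts : length L ≡ m * 2
      length-allDarts = trans (length-pairs (allFin m)) (cong (_* 2) (length-tabulate {n = m} (λ z → z)))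

  -- Q has 8m more vertices, 12m more edges and 4m more faces than N, so
  -- Euler's formula for N gives Euler's formula for Q.
  planarQ : n + faces N R ≡ m + 2 → Planar (Q N R)
  planarQ euler = rotationQ , (begin
      n + m * (2 * 4) + faces (Q N R) rotationQ                ≡⟨ cong (n + m * (2 * 4) +_) facesQ ⟩
      n + m * (2 * 4) + (m * 2 + (m * 2 + (faces N R + 0)))    ≡⟨ rearrange n m (faces N R) ⟩
      (n + faces N R) + m * 12                                 ≡⟨ cong (_+ m * 12) euler ⟩
      m + 2 + m * 12                                           ≡⟨ collect m ⟩
      m * 13 + 2                                               ∎)
    where
      open ≡-Reasoning
      rearrange : ∀ a b c → a + b * (2 * 4) + (b * 2 + (b * 2 + (c + 0))) ≡ (a + c) + b * 12
      rearrange = solve-∀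
      collect : ∀ b → b + 2 + b * 12 ≡ b * 13 + 2
      collect = solve-∀

miss-one-of-three : ∀ {A D : Set} (Hit : A → D → Set) → (∀ a d → Dec (Hit a d))
  → ∀ x y d₁ d₂ d₃
  → (∀ z → Hit z d₁ → Hit z d₂ → ⊥) → (∀ z → Hit z d₁ → Hit z d₃ → ⊥)
  → (∀ z → Hit z d₂ → Hit z d₃ → ⊥)
  → (¬ Hit x d₁ × ¬ Hit y d₁) ⊎ (¬ Hit x d₂ × ¬ Hit y d₂) ⊎ (¬ Hit x d₃ × ¬ Hit y d₃)
miss-one-of-three Hit hit? x y d₁ d₂ d₃ ex₁₂ ex₁₃ ex₂₃
  with hit? x d₁ | hit? y d₁ | hit? x d₂ | hit? y d₂ | hit? x d₃ | hit? y d₃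
... | no p  | no q  | _     | _     | _     | _     = inj₁ (p , q)
... | _     | _     | no p  | no q  | _     | _     = inj₂ (inj₁ (p , q))
... | _     | _     | _     | _     | no p  | no q  = inj₂ (inj₂ (p , q))
... | yes p | _     | yes q | _     | _     | _     = ⊥-elim (ex₁₂ x p q)
... | _     | yes p | _     | yes q | _     | _     = ⊥-elim (ex₁₂ y p q)
... | yes p | _     | _     | _     | yes q | _     = ⊥-elim (ex₁₃ x p q)
... | _     | yes p | _     | _     | _     | yes q = ⊥-elim (ex₁₃ y p q)
... | _     | _     | yes p | _     | yes q | _     = ⊥-elim (ex₂₃ x p q)
... | _     | _     | _     | yes p | _     | yes q = ⊥-elim (ex₂₃ y p q)

three-distinct : ∀ {k} → 3 < k
               → Σ (Fin k) λ c₁ → Σ (Fin k) λ c₂ → Σ (Fin k) λ c₃ → c₁ ≢ c₂ × c₁ ≢ c₃ × c₂ ≢ c₃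
three-distinct (s≤s (s≤s (s≤s (s≤s _)))) = F.zero , F.suc F.zero , F.suc (F.suc F.zero) , (λ ()) , (λ ()) , (λ ())

module Cubic-graph (G : MGraph) (cubic : Cubic G) where
  open MGraph G
  open Darts G using (allDarts-unique)

  record ThreeDarts (a : Fin n) : Set where
    field
      η₁ η₂ η₃ : Dart G
      tail₁ : tail G η₁ ≡ a
      tail₂ : tail G η₂ ≡ a
      tail₃ : tail G η₃ ≡ a
      η₁≢η₂ : η₁ ≢ η₂
      η₁≢η₃ : η₁ ≢ η₃
      η₂≢η₃ : η₂ ≢ η₃

  threeDarts : ∀ a → ThreeDarts a
  threeDarts a = from-list (filter (λ d → tail G d ≟F a) (allDarts G)) refl (cubic a)
    where
      at-a? : Decidable (λ d → tail G d ≡ a)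
      at-a? d = tail G d ≟F a

      from-list : ∀ ds → ds ≡ filter at-a? (allDarts G) → length ds ≡ 3 → ThreeDarts a
      from-list (d₁ ∷ d₂ ∷ d₃ ∷ []) eq _ = record
        { η₁ = d₁ ; η₂ = d₂ ; η₃ = d₃
        ; tail₁ = leaves (here refl) ; tail₂ = leaves (there (here refl)) ; tail₃ = leaves (there (there (here refl)))
        ; η₁≢η₂ = All.lookup fresh₁ (here refl) ; η₁≢η₃ = All.lookup fresh₁ (there (here refl))
        ; η₂≢η₃ = All.lookup fresh₂ (here refl) }
        where
          leaves : ∀ {d} → d ∈ (d₁ ∷ d₂ ∷ d₃ ∷ []) → tail G d ≡ a
          leaves {d} p = proj₂ (∈-filter⁻ at-a? {xs = allDarts G} (subst (d ∈_) eq p))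
          unique : Unique (d₁ ∷ d₂ ∷ d₃ ∷ [])
          unique = subst Unique (sym eq) (Unique.filter⁺ at-a? allDarts-unique)
          fresh₁ : All (d₁ ≢_) (d₂ ∷ d₃ ∷ [])
          fresh₁ = AllPairs.head unique
          fresh₂ : All (d₂ ≢_) (d₃ ∷ [])
          fresh₂ = AllPairs.head (AllPairs.tail unique)

  -- If σ fixed a dart, cyclicity would make it the only dart at its tail.
  σ-no-fixpoint : (Rot : Rotation G) → ∀ d → Rotation.σ Rot d ≢ d
  σ-no-fixpoint Rot d fixed =
    ThreeDarts.η₁≢η₂ darts (trans (only (ThreeDarts.tail₁ darts)) (sym (only (ThreeDarts.tail₂ darts))))
    where
      open Rotation Rot
      darts : ThreeDarts (tail G d)
      darts = threeDarts (tail G d)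
      iterate-fixed : ∀ k → iter G σ k d ≡ d
      iterate-fixed zero    = refl
      iterate-fixed (suc k) = trans (cong σ (iterate-fixed k)) fixed
      only : ∀ {d′} → tail G d′ ≡ tail G d → d′ ≡ d
      only t with cyclic d _ (sym t)
      ... | (k , e) = trans (sym e) (iterate-fixed k)

module PathsQ (N : MGraph) (R : Rotation N) where
  open MGraph N
  open Rotation R
  open Coordinates N R
  open Darts N using (rev-rev; _≟D_)
  open Walks (Q N R)

  Adjacent : QVertex → QVertex → Set
  Adjacent v w = Σ QEdge λ q → endsV q ≡ (v , w) ⊎ endsV q ≡ (w , v)

  flip : ∀ {v w} → Adjacent v w → Adjacent w v
  flip (q , inj₁ e) = q , inj₂ e
  flip (q , inj₂ e) = q , inj₁ e

  infixr 5 _▸_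

  -- A path from u to w whose vertices after u are vs.
  data Path : QVertex → List QVertex → QVertex → Set where
    done : ∀ {v} → Path v [] v
    _▸_  : ∀ {u v vs w} → Adjacent u v → Path v vs w → Path u (v ∷ vs) w

  dartOf : ∀ {u v} → Adjacent u v → Σ (Dart (Q N R)) λ d → tail (Q N R) d ≡ unview u × head (Q N R) d ≡ unview v
  dartOf (q , inj₁ e) = (toE q , true)  , endOf q proj₁ e , endOf q proj₂ e
  dartOf (q , inj₂ e) = (toE q , false) , endOf q proj₂ e , endOf q proj₁ e

  pathR : ∀ {X u vs w} → Path u vs w → ¬ X (unview u) → All (λ z → ¬ X (unview z)) vs
        → Reach (Q N R) X (unview u) (unview w)
  pathR done nu [] = here nu
  pathR {X} {w = w} (a ▸ p) nu (nv ∷ nvs) with dartOf a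
  ... | (d , t , h) = step d t nu (subst (λ z → Reach (Q N R) X z (unview w)) (sym h) (pathR p nv nvs))

  edge-oa : ∀ δ → Adjacent (old (tail N δ)) (new δ kA)
  edge-oa δ = gadget δ oa , inj₁ refl

  edge-ab : ∀ δ → Adjacent (new δ kA) (new δ kB)
  edge-ab δ = gadget δ ab , inj₁ refl

  edge-bc : ∀ δ → Adjacent (new δ kB) (new δ kC)
  edge-bc δ = gadget δ bc , inj₁ refl

  edge-cd : ∀ δ → Adjacent (new δ kC) (new δ kD)
  edge-cd δ = gadget δ cd , inj₁ refl

  edge-da : ∀ δ → Adjacent (new δ kD) (new (rev N δ) kA)
  edge-da δ = gadget δ da , inj₁ refl

  edge-cb : ∀ δ → Adjacent (new δ kC) (new (next N R δ) kB)
  edge-cb δ = gadget δ cb , inj₁ refl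

  edge-dd : ∀ δ → Adjacent (new δ kD) (new (rev N δ) kD)
  edge-dd (i , true)  = rung i , inj₁ refl
  edge-dd (i , false) = rung i , inj₂ refl

  toTail : ∀ δ k → Σ (List QVertex) λ vs → Path (new δ k) vs (old (tail N δ))
  toTail δ kA = _ , flip (edge-oa δ) ▸ done
  toTail δ kB = _ , flip (edge-ab δ) ▸ flip (edge-oa δ) ▸ done
  toTail δ kC = _ , flip (edge-bc δ) ▸ flip (edge-ab δ) ▸ flip (edge-oa δ) ▸ done
  toTail δ kD = _ , flip (edge-cd δ) ▸ flip (edge-bc δ) ▸ flip (edge-ab δ) ▸ flip (edge-oa δ) ▸ done

  dToHead : ∀ δ → Path (new δ kD) (new (rev N δ) kA ∷ old (head N δ) ∷ []) (old (head N δ))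
  dToHead δ = edge-da δ ▸ flip (edge-oa (rev N δ)) ▸ done

  gadgetPath : ∀ δ → Path (old (tail N δ))
    (new δ kA ∷ new δ kB ∷ new δ kC ∷ new δ kD ∷ new (rev N δ) kA ∷ old (head N δ) ∷ []) (old (head N δ))
  gadgetPath δ = edge-oa δ ▸ edge-ab δ ▸ edge-bc δ ▸ edge-cd δ ▸ dToHead δ

  _≟V_ : (v w : QVertex) → Dec (v ≡ w)
  old r ≟V old r′ with r ≟F r′
  ... | yes refl = yes refl
  ... | no ne    = no (λ { refl → ne refl })
  old r ≟V new _ _ = no (λ ())
  new _ _ ≟V old r = no (λ ())
  new δ k ≟V new δ′ k′ with δ ≟D δ′ | k ≟F k′
  ... | yes refl | yes refl = yes refl
  ... | no ne    | _        = no (λ { refl → ne refl })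
  ... | yes _    | no ne    = no (λ { refl → ne refl })

  Apart : QVertex → QVertex → Set
  Apart (old r)   (old r′)    = r ≢ r′
  Apart (old _)   (new _ _)   = ⊤
  Apart (new _ _) (old _)     = ⊤
  Apart (new δ k) (new δ′ k′) = if does (k ≟F k′) then δ ≢ δ′ else ⊤

  apart⇒≢ : ∀ v w → Apart v w → v ≢ w
  apart⇒≢ (old r)   (old .r)   p refl = p refl
  apart⇒≢ (new δ k) (new .δ .k) p refl with k ≟F k
  ... | yes _ = p refl
  ... | no ne = ne refl

  Separated : List QVertex → List QVertex → Set
  Separated vs ws = All (λ v → All (Apart v) ws) vs

  separated⇒disjoint : ∀ {vs ws w} → Separated vs ws → w ∈ vs → w ∈ ws → ⊥
  separated⇒disjoint {v ∷ vs} (pv ∷ ps) (here refl) w∈ = apart⇒≢ v v (All.lookup pv w∈) refl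
  separated⇒disjoint {v ∷ vs} (pv ∷ ps) (there w∈) w∈′ = separated⇒disjoint ps w∈ w∈′

  record Fan (z : QVertex) : Set where
    field
      end₁ end₂ end₃       : Fin n
      route₁ route₂ route₃ : List QVertex
      path₁ : Path z route₁ (old end₁)
      path₂ : Path z route₂ (old end₂)
      path₃ : Path z route₃ (old end₃)
      sep₁₂ : Separated route₁ route₂
      sep₁₃ : Separated route₁ route₃
      sep₂₃ : Separated route₂ route₃

  open import Data.List.Membership.DecPropositional _≟V_ using (_∈?_)

  avoid : ∀ (x y : QV N R) vs → ¬ view x ∈ vs → ¬ view y ∈ vs → All (λ w → ¬ (unview w ≡ x ⊎ unview w ≡ y)) vs
  avoid x y []       _  _  = []
  avoid x y (v ∷ vs) mx my = missed ∷ avoid x y vs (λ p → mx (there p)) (λ p → my (there p))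
    where
      missed : ¬ (unview v ≡ x ⊎ unview v ≡ y)
      missed (inj₁ refl) = mx (here (view-unview v))
      missed (inj₂ refl) = my (here (view-unview v))

  -- Deleting two vertices other than z leaves one path of a fan intact.
  fan-escape : ∀ {z} (x y : QV N R) → Fan z → ¬ (unview z ≡ x ⊎ unview z ≡ y)
             → ∃[ e ] Reach (Q N R) (λ w → w ≡ x ⊎ w ≡ y) (unview z) (O N R e)
  fan-escape {z} x y F nz
    with miss-one-of-three _∈_ (λ v vs → v ∈? vs) (view x) (view y) (Fan.route₁ F) (Fan.route₂ F) (Fan.route₃ F)
           (λ _ → separated⇒disjoint (Fan.sep₁₂ F)) (λ _ → separated⇒disjoint (Fan.sep₁₃ F))
           (λ _ → separated⇒disjoint (Fan.sep₂₃ F))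
  ... | inj₁ (mx , my)        = Fan.end₁ F , pathR (Fan.path₁ F) nz (avoid x y _ mx my)
  ... | inj₂ (inj₁ (mx , my)) = Fan.end₂ F , pathR (Fan.path₂ F) nz (avoid x y _ mx my)
  ... | inj₂ (inj₂ (mx , my)) = Fan.end₃ F , pathR (Fan.path₃ F) nz (avoid x y _ mx my)

module ThreeConnectivity (N : MGraph) (R : Rotation N) (simple : Simple N) (cubic : Cubic N) where
  open MGraph N
  open Rotation R
  open Coordinates N R
  open RotationQ N R using (prev; next-prev)
  open Darts N using (rev-rev; rev-inj; rev≢; _≟D_)
  open SimpleGraph N simple
  open Cubic-graph N cubic
  open PathsQ N R
  open Walks (Q N R)

  -- Facts about darts of N that make the fan paths below disjoint; they use
  -- that N is simple and that σ has no fixed point.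

  σ≢ : ∀ δ → σ δ ≢ δ
  σ≢ = σ-no-fixpoint R

  tail-next : ∀ δ → tail N (next N R δ) ≡ head N δ
  tail-next δ = σtail (rev N δ)

  head-prev : ∀ δ → head N (prev δ) ≡ tail N δ
  head-prev δ = trans (cong (tail N) (rev-rev (σ⁻¹ δ))) (trans (sym (σtail (σ⁻¹ δ))) (cong (tail N) (σσ⁻¹ δ)))

  tail≢head-next : ∀ δ → tail N δ ≢ head N (next N R δ)
  tail≢head-next δ e =
    σ≢ (rev N δ) (parallel (next N R δ) (rev N δ) (tail-next δ) (trans (sym e) (sym (cong (tail N) (rev-rev δ)))))

  ≢prev : ∀ δ → δ ≢ prev δ
  ≢prev δ e = loopless (prev δ) (trans (sym (cong (tail N) e)) (sym (head-prev δ)))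

  tail≢tail-prev : ∀ δ → tail N δ ≢ tail N (prev δ)
  tail≢tail-prev δ e = loopless (prev δ) (trans (sym e) (sym (head-prev δ)))

  rev≢prev : ∀ δ → rev N δ ≢ prev δ
  rev≢prev δ e = σ≢ δ (trans (cong σ (rev-inj e)) (σσ⁻¹ δ))

  head≢tail-prev : ∀ δ → head N δ ≢ tail N (prev δ)
  head≢tail-prev δ e = σ≢ δ (trans (cong σ (sym (parallel (σ⁻¹ δ) δ tail-σ⁻¹ (sym e)))) (σσ⁻¹ δ))
    where tail-σ⁻¹ : tail N (σ⁻¹ δ) ≡ tail N δ
          tail-σ⁻¹ = trans (sym (σtail (σ⁻¹ δ))) (cong (tail N) (σσ⁻¹ δ))

  tail≢head-σ : ∀ δ → tail N δ ≢ head N (σ δ)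
  tail≢head-σ δ e = loopless (σ δ) (trans (σtail δ) e)

  head≢head-σ : ∀ δ → head N δ ≢ head N (σ δ)
  head≢head-σ δ e = σ≢ δ (parallel (σ δ) δ (σtail δ) (sym e))

  fanA : ∀ δ → Fan (new δ kA)
  fanA δ = record
    { end₁ = tail N δ ; end₂ = head N (next N R δ) ; end₃ = head N δ
    ; route₁ = _ ; route₂ = _ ; route₃ = _
    ; path₁ = proj₂ (toTail δ kA)
    ; path₂ = edge-ab δ ▸ edge-bc δ ▸ edge-cb δ ▸ edge-bc (next N R δ) ▸ edge-cd (next N R δ) ▸ dToHead (next N R δ)
    ; path₃ = subst (λ z → Adjacent (new z kA) (new (rev N δ) kD)) (rev-rev δ) (flip (edge-da (rev N δ)))
              ▸ flip (edge-dd δ) ▸ dToHead δ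
    ; sep₁₂ = (tt ∷ tt ∷ tt ∷ tt ∷ tt ∷ tt ∷ tail≢head-next δ ∷ []) ∷ []
    ; sep₁₃ = (tt ∷ tt ∷ tt ∷ loopless δ ∷ []) ∷ []
    ; sep₂₃ = (tt ∷ tt ∷ tt ∷ tt ∷ []) ∷ (tt ∷ tt ∷ tt ∷ tt ∷ []) ∷ (tt ∷ tt ∷ tt ∷ tt ∷ []) ∷ (tt ∷ tt ∷ tt ∷ tt ∷ [])
            ∷ (σ≢ (rev N δ) ∷ next≢ R δ ∷ tt ∷ tt ∷ []) ∷ (tt ∷ tt ∷ (λ e → next≢ R δ (rev-inj e)) ∷ tt ∷ [])
            ∷ (tt ∷ tt ∷ tt ∷ (λ e → loopless (next N R δ) (trans (tail-next δ) (sym e))) ∷ []) ∷ []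
    }

  fanB : ∀ δ → Fan (new δ kB)
  fanB δ = record
    { end₁ = tail N δ ; end₂ = head N δ ; end₃ = tail N (prev δ)
    ; route₁ = _ ; route₂ = _ ; route₃ = _
    ; path₁ = proj₂ (toTail δ kB)
    ; path₂ = edge-bc δ ▸ edge-cd δ ▸ dToHead δ
    ; path₃ = subst (λ z → Adjacent (new z kB) (new (prev δ) kC)) (next-prev δ) (flip (edge-cb (prev δ)))
              ▸ proj₂ (toTail (prev δ) kC)
    ; sep₁₂ = (tt ∷ tt ∷ (λ e → rev≢ δ (sym e)) ∷ tt ∷ []) ∷ (tt ∷ tt ∷ tt ∷ loopless δ ∷ []) ∷ []
    ; sep₁₃ = (tt ∷ tt ∷ ≢prev δ ∷ tt ∷ []) ∷ (tt ∷ tt ∷ tt ∷ tail≢tail-prev δ ∷ []) ∷ []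
    ; sep₂₃ = (≢prev δ ∷ tt ∷ tt ∷ tt ∷ []) ∷ (tt ∷ tt ∷ tt ∷ tt ∷ []) ∷ (tt ∷ tt ∷ rev≢prev δ ∷ tt ∷ [])
            ∷ (tt ∷ tt ∷ tt ∷ head≢tail-prev δ ∷ []) ∷ []
    }

  fanC : ∀ δ → Fan (new δ kC)
  fanC δ = record
    { end₁ = tail N δ ; end₂ = head N δ ; end₃ = head N (next N R δ)
    ; route₁ = _ ; route₂ = _ ; route₃ = _
    ; path₁ = proj₂ (toTail δ kC)
    ; path₂ = edge-cd δ ▸ dToHead δ
    ; path₃ = edge-cb δ ▸ edge-bc (next N R δ) ▸ edge-cd (next N R δ) ▸ dToHead (next N R δ)
    ; sep₁₂ = (tt ∷ tt ∷ tt ∷ []) ∷ (tt ∷ (λ e → rev≢ δ (sym e)) ∷ tt ∷ []) ∷ (tt ∷ tt ∷ loopless δ ∷ []) ∷ []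
    ; sep₁₃ = ((λ e → next≢ R δ (sym e)) ∷ tt ∷ tt ∷ tt ∷ tt ∷ [])
            ∷ (tt ∷ tt ∷ tt ∷ (λ e → tail≢head-next δ (cong (tail N) e)) ∷ tt ∷ [])
            ∷ (tt ∷ tt ∷ tt ∷ tt ∷ tail≢head-next δ ∷ []) ∷ []
    ; sep₂₃ = (tt ∷ tt ∷ (λ e → next≢ R δ (sym e)) ∷ tt ∷ tt ∷ [])
            ∷ (tt ∷ tt ∷ tt ∷ (λ e → next≢ R δ (sym (rev-inj e))) ∷ tt ∷ [])
            ∷ (tt ∷ tt ∷ tt ∷ tt ∷ (λ e → loopless (next N R δ) (trans (tail-next δ) e)) ∷ []) ∷ []
    }

  fanD : ∀ δ → Fan (new δ kD)
  fanD δ = record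
    { end₁ = tail N δ ; end₂ = head N δ ; end₃ = head N (σ δ)
    ; route₁ = _ ; route₂ = _ ; route₃ = _
    ; path₁ = proj₂ (toTail δ kD)
    ; path₂ = dToHead δ
    ; path₃ = edge-dd δ ▸ flip (edge-cd (rev N δ))
              ▸ subst (λ z → Adjacent (new (rev N δ) kC) (new (σ z) kB)) (rev-rev δ) (edge-cb (rev N δ))
              ▸ edge-bc (σ δ) ▸ edge-cd (σ δ) ▸ dToHead (σ δ)
    ; sep₁₂ = (tt ∷ tt ∷ []) ∷ (tt ∷ tt ∷ []) ∷ ((λ e → rev≢ δ (sym e)) ∷ tt ∷ []) ∷ (tt ∷ loopless δ ∷ []) ∷ []
    ; sep₁₃ = (tt ∷ (λ e → rev≢ δ (sym e)) ∷ tt ∷ (λ e → σ≢ δ (sym e)) ∷ tt ∷ tt ∷ tt ∷ [])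
            ∷ (tt ∷ tt ∷ (λ e → σ≢ δ (sym e)) ∷ tt ∷ tt ∷ tt ∷ tt ∷ [])
            ∷ (tt ∷ tt ∷ tt ∷ tt ∷ tt ∷ (λ e → tail≢head-σ δ (cong (tail N) e)) ∷ tt ∷ [])
            ∷ (tt ∷ tt ∷ tt ∷ tt ∷ tt ∷ tt ∷ tail≢head-σ δ ∷ []) ∷ []
    ; sep₂₃ = (tt ∷ tt ∷ tt ∷ tt ∷ tt ∷ (λ e → σ≢ δ (sym (rev-inj e))) ∷ tt ∷ [])
            ∷ (tt ∷ tt ∷ tt ∷ tt ∷ tt ∷ tt ∷ head≢head-σ δ ∷ []) ∷ []
    }

  fan : ∀ δ k → Fan (new δ k)
  fan δ kA = fanA δ
  fan δ kB = fanB δ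
  fan δ kC = fanC δ
  fan δ kD = fanD δ

  over : QVertex → Fin n
  over (old r)   = r
  over (new ε k) = tail N ε

  module Separation (x y : QV N R) (sepN : Connected-minus-two N) where

    Deleted : QV N R → Set
    Deleted w = w ≡ x ⊎ w ≡ y

    Damaged : Fin n → Set
    Damaged a = a ≡ over (view x) ⊎ a ≡ over (view y)

    intact : ∀ v → ¬ Damaged (over v) → ¬ Deleted (unview v)
    intact v nd (inj₁ refl) = nd (inj₁ (cong over (sym (view-unview v))))
    intact v nd (inj₂ refl) = nd (inj₂ (cong over (sym (view-unview v))))

    gadgetR : ∀ δ → ¬ Deleted (O N R (tail N δ)) → (∀ k → ¬ Deleted (newV N R δ k)) → ¬ Damaged (head N δ)
            → Reach (Q N R) Deleted (O N R (tail N δ)) (O N R (head N δ))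
    gadgetR δ nt nk nh =
      pathR (gadgetPath δ) nt (nk kA ∷ nk kB ∷ nk kC ∷ nk kD ∷ intact (new (rev N δ) kA) nh ∷ intact (old _) nh ∷ [])

    lift : ∀ {a b} → Reach N Damaged a b → Reach (Q N R) Deleted (O N R a) (O N R b)
    lift (here nd)           = here (intact (old _) nd)
    lift (step δ refl nd r)  =
      gadgetR δ (intact (old _) nd) (λ k → intact (new δ k) nd) (Walks.start-ok N r) ++R lift r

    Blocks : QVertex → Dart N → Set
    Blocks v η = (∃[ k ] v ≡ new η k) ⊎ head N η ≡ over v

    blocks? : ∀ v η → Dec (Blocks v η)
    blocks? v η with head N η ≟F over v
    blocks? v η       | yes e = yes (inj₂ e)
    blocks? (old r) η | no ne = no λ { (inj₁ (_ , ())) ; (inj₂ e) → ne e }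
    blocks? (new ε k) η | no ne with ε ≟D η
    ... | yes refl = yes (inj₁ (k , refl))
    ... | no nε    = no λ { (inj₁ (_ , refl)) → nε refl ; (inj₂ e) → ne e }

    blocks-unique : ∀ v η η′ → tail N η ≡ tail N η′ → Blocks v η → Blocks v η′ → η ≡ η′
    blocks-unique v η η′ t (inj₁ (k , refl)) (inj₁ (_ , refl)) = refl
    blocks-unique v η η′ t (inj₁ (k , refl)) (inj₂ e)          = ⊥-elim (loopless η′ (trans (sym t) (sym e)))
    blocks-unique v η η′ t (inj₂ e)          (inj₁ (k , refl)) = ⊥-elim (loopless η (trans t (sym e)))
    blocks-unique v η η′ t (inj₂ e)          (inj₂ e′)         = parallel η η′ t (trans e (sym e′))

    exit-along : ∀ {a} η → tail N η ≡ a → ¬ Deleted (O N R a) → ¬ Blocks (view x) η → ¬ Blocks (view y) η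
               → ∃[ b ] (¬ Damaged b × Reach (Q N R) Deleted (O N R a) (O N R b))
    exit-along η refl na bx by = head N η , undamaged , gadgetR η na on-gadget undamaged
      where
        undamaged : ¬ Damaged (head N η)
        undamaged (inj₁ e) = bx (inj₂ e)
        undamaged (inj₂ e) = by (inj₂ e)
        on-gadget : ∀ k → ¬ Deleted (newV N R η k)
        on-gadget k (inj₁ refl) = bx (inj₁ (k , view-new η k))
        on-gadget k (inj₂ refl) = by (inj₁ (k , view-new η k))

    -- From any surviving old vertex, one of its three gadgets leads to an
    -- undamaged vertex of N.
    exit-old : ∀ a → ¬ Deleted (O N R a) → ∃[ b ] (¬ Damaged b × Reach (Q N R) Deleted (O N R a) (O N R b))
    exit-old a na
      with miss-one-of-three Blocks blocks? (view x) (view y) η₁ η₂ η₃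
             (λ z p q → η₁≢η₂ (blocks-unique z η₁ η₂ (trans tail₁ (sym tail₂)) p q))
             (λ z p q → η₁≢η₃ (blocks-unique z η₁ η₃ (trans tail₁ (sym tail₃)) p q))
             (λ z p q → η₂≢η₃ (blocks-unique z η₂ η₃ (trans tail₂ (sym tail₃)) p q))
      where open ThreeDarts (threeDarts a)
    ... | inj₁ (bx , by)        = exit-along η₁ tail₁ na bx by where open ThreeDarts (threeDarts a)
    ... | inj₂ (inj₁ (bx , by)) = exit-along η₂ tail₂ na bx by where open ThreeDarts (threeDarts a)
    ... | inj₂ (inj₂ (bx , by)) = exit-along η₃ tail₃ na bx by where open ThreeDarts (threeDarts a)

    exit : ∀ u → ¬ Deleted u → ∃[ b ] (¬ Damaged b × Reach (Q N R) Deleted u (O N R b))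
    exit u nu = subst (λ z → ∃[ b ] (¬ Damaged b × Reach (Q N R) Deleted z (O N R b))) (unview-view u)
                      (exit-view (view u) (subst (λ z → ¬ Deleted z) (sym (unview-view u)) nu))
      where
        exit-view : ∀ v → ¬ Deleted (unview v) → ∃[ b ] (¬ Damaged b × Reach (Q N R) Deleted (unview v) (O N R b))
        exit-view (old a)   nv = exit-old a nv
        exit-view (new δ k) nv with fan-escape x y (fan δ k) nv
        ... | (e , r) with exit-old e (end-ok r)
        ... | (b , nb , r′) = b , nb , (r ++R r′)

    connect : ∀ u v → ¬ Deleted u → ¬ Deleted v → Reach (Q N R) Deleted u v
    connect u v nu nv with exit u nu | exit v nv
    ... | (b₁ , n₁ , r₁) | (b₂ , n₂ , r₂) =
      r₁ ++R (lift (sepN _ _ b₁ b₂ (λ e → n₁ (inj₁ e)) (λ e → n₁ (inj₂ e)) (λ e → n₂ (inj₁ e)) (λ e → n₂ (inj₂ e)))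
         ++R reverseR r₂)

  O-inj : ∀ {a b} → O N R a ≡ O N R b → a ≡ b
  O-inj {a} {b} e with trans (sym (view-old a)) (trans (cong view e) (view-old b))
  ... | refl = refl

  -- Q minus one old vertex O c other than u and v is connected, hence so is Q.
  connect-avoiding : Connected-minus-two (Q N R) → ∀ c u v → O N R c ≢ u → O N R c ≢ v → Reach (Q N R) (λ _ → ⊥) u v
  connect-avoiding separation c u v pu pv = monoR (λ _ ()) (separation (O N R c) (O N R c) u v
    (λ e → pu (sym e)) (λ e → pu (sym e)) (λ e → pv (sym e)) (λ e → pv (sym e)))

  threeConnectedQ : ThreeConnected N → ThreeConnected (Q N R)
  threeConnectedQ (big , _ , sepN) = ≤-trans big (m≤m+n n (m * (2 * 4))) , connected , separation
    where
      separation : Connected-minus-two (Q N R)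
      separation x y u v ux uy vx vy = Separation.connect x y sepN u v
        (λ { (inj₁ e) → ux e ; (inj₂ e) → uy e }) (λ { (inj₁ e) → vx e ; (inj₂ e) → vy e })

      connected : Connected (Q N R)
      connected u v with three-distinct big
      ... | (c₁ , c₂ , c₃ , c₁≢c₂ , c₁≢c₃ , c₂≢c₃)
        with miss-one-of-three (λ z c → O N R c ≡ z) (λ z c → O N R c ≟F z) u v c₁ c₂ c₃
               (λ _ p q → c₁≢c₂ (O-inj (trans p (sym q)))) (λ _ p q → c₁≢c₃ (O-inj (trans p (sym q))))
               (λ _ p q → c₂≢c₃ (O-inj (trans p (sym q))))
      ... | inj₁ (pu , pv)        = connect-avoiding separation c₁ u v pu pv
      ... | inj₂ (inj₁ (pu , pv)) = connect-avoiding separation c₂ u v pu pv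
      ... | inj₂ (inj₂ (pu , pv)) = connect-avoiding separation c₃ u v pu pv

lemma4p3 : (N : MGraph) → Simple N → Cubic N → ThreeConnected N
    → (R : Rotation N) → MGraph.n N + faces N R ≡ MGraph.m N + 2
    → ThreeConnected (Q N R) × Planar (Q N R) × Simple (Q N R)
lemma4p3 N simple cubic threeConnected R euler =
    ThreeConnectivity.threeConnectedQ N R simple cubic threeConnected
  , FacesQ.planarQ N R euler
  , Simplicity.simpleQ N R simple
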